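{- Let $n\ge 2$ and $w\in\mathcal S_n$. Define a relation on the commutation classes of $\mathrm{R}(w)$ as the transitive closure of the covering relations $[a]<[b]$ whenever $a$ and $b$ differ by a single long braid relation and $t(b)=t(a)+1$. This relation is a partial order making $C(w)$ into a ranked partially ordered set (with rank function $t$) having a unique minimal element $[a_{\min}]$ and a unique maximal element $[a_{\max}]$.
   Context: Applying a letter $i\in\{1,\dots,n-1\}$ to a word of length $n$ swaps its entries in positions $i$ and $i+1$. The length $\ell(w)$ is the number of inversions of $w$ (pairs of values $p>q$ with $p$ appearing before $q$ in $w$). A reduced word of $w$ is a word $a=a_1\cdots a_{\ell(w)}$ over $\{1,\dots,n-1\}$ such that applying successively $a_1,\dots,a_{\ell(w)}$ to the identity word $12\cdots n$ yields $w$; $\mathrm{R}(w)$ is the set of reduced words. In this process, each letter $a_j$ swaps two adjacent values $q<p$, and each inversion pair $(p,q)$ of $w$ is swapped by exactly one letter; the canonical labelling of $a$ is $P_a(p,q)=j$ iff the $j$-th letter $a_j$ swaps $p$ and $q$. Two reduced words differ by a commutation if one is obtained from the other by replacing a factor $ij$ with $|i-j|\ge2$ by $ji$; they differ by a long braid relation if one is obtained from the other by replacing a factor $i(i+1)i$ by $(i+1)i(i+1)$ or vice versa. $[a]$ denotes the commutation class (class under sequences of commutations). $C(w)$ is the graph whose vertices are the commutation classes, with an edge between $[a],[b]$ when some $a'\in[a]$, $b'\in[b]$ differ by a single long braid relation. $\mathrm{T}_w$ is the set of triples $(x,y,z)$ with $x<y<z$ such that $z$ appears before $y$ and $y$ before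 $x$ in $w$. For $a\in\mathrm{R}(w)$ and $(x,y,z)\in\mathrm{T}_w$, $\Gamma(a,(x,y,z))=1$ if $P_a(y,x)>P_a(z,y)$ and $0$ if $P_a(y,x)<P_a(z,y)$. For $a,b\in\mathrm{R}(w)$, $t(a,b)$ is the number of triples $\tau\in\mathrm{T}_w$ with $\Gamma(a,\tau)\ne\Gamma(b,\tau)$, and $t(a)=t(a_{\min},a)$. The words $a_{\min},a_{\max}$: set $w^0=w$ and, while $w^j$ is not the identity, let $i_j$ be the smallest (for $a_{\min}$), resp. largest (for $a_{\max}$), descent of $w^j$ (an index $i$ with $w^j_i>w^j_{i+1}$) and let $w^{j+1}$ be $w^j$ with the entries in positions $i_j,i_j+1$ swapped; this stops after $\ell(w)$ steps at the identity, and the reduced word is $i_{\ell(w)-1}\cdots i_1 i_0$ (the chosen descents in reverse order). -}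

module Defs where

open import Data.Nat using (ℕ; zero; suc; _+_; _≤_; _<_; _<ᵇ_; _≡ᵇ_; _∸_)
open import Data.Bool using (Bool; true; false; if_then_else_; _∧_; not)
open import Data.List using (List; []; _∷_; _++_; map; length; upTo; reverse; concatMap)
open import Data.List.Relation.Unary.All using (All)
open import Data.List.Relation.Binary.Permutation.Propositional using (_↭_)
open import Data.Product using (Σ; _×_; _,_; proj₁; ∃; ∃-syntax)
open import Data.Sum using (_⊎_)
open import Relation.Nullary using (¬_)
open import Relation.Binary.PropositionalEquality using (_≡_)
open import Relation.Binary.Construct.Closure.ReflexiveTransitive using (Star)
open import Relation.Binary.Construct.Closure.Transitive using (TransClosure)

-- Words and permutations (entries are the values 1..n, positions are 1-based)

idWord : ℕ → List ℕ
idWord n = map suc (upTo n)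

-- w is (the one-line notation of) an element of S_n
IsPerm : ℕ → List ℕ → Set
IsPerm n w = w ↭ idWord n

swapAt : ℕ → List ℕ → List ℕ
swapAt (suc zero)    (x ∷ y ∷ xs) = y ∷ x ∷ xs
swapAt (suc (suc i)) (x ∷ xs)     = x ∷ swapAt (suc i) xs
swapAt _             xs           = xs

act : List ℕ → List ℕ → List ℕ
act u []      = u
act u (i ∷ a) = act (swapAt i u) a

countLess : ℕ → List ℕ → ℕ
countLess x []       = 0
countLess x (y ∷ ys) = if y <ᵇ x then suc (countLess x ys) else countLess x ys

-- length ℓ(w) = number of inversions
inv : List ℕ → ℕ
inv []       = 0
inv (x ∷ xs) = countLess x xs + inv xs

Letter : ℕ → ℕ → Set
Letter n i = 1 ≤ i × i < n

Reduced : ℕ → List ℕ → List ℕ → Set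
Reduced n w a = All (Letter n) a × act (idWord n) a ≡ w × length a ≡ inv w

RW : ℕ → List ℕ → Set
RW n w = Σ (List ℕ) (Reduced n w)

swappedPair : ℕ → List ℕ → ℕ × ℕ
swappedPair (suc zero)    (x ∷ y ∷ xs) = (if y <ᵇ x then (x , y) else (y , x))
swappedPair (suc (suc i)) (x ∷ xs)     = swappedPair (suc i) xs
swappedPair _             xs           = (0 , 0)

swaps : List ℕ → List ℕ → List (ℕ × ℕ)
swaps u []      = []
swaps u (i ∷ a) = swappedPair i u ∷ swaps (swapAt i u) a

-- 1-based index of the first occurrence of (p , q) in the list (0 if absent)
indexOf : ℕ × ℕ → List (ℕ × ℕ) → ℕ
indexOf pq [] = 0
indexOf (p , q) ((p' , q') ∷ rest) =
  if (p ≡ᵇ p') ∧ (q ≡ᵇ q') then 1 else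
    (if indexOf (p , q) rest ≡ᵇ 0 then 0 else suc (indexOf (p , q) rest))

-- P_a(p,q) : the index j such that a_j swaps p and q (p > q)
P : ℕ → List ℕ → ℕ → ℕ → ℕ
P n a p q = indexOf (p , q) (swaps (idWord n) a)

-- 1-based position of the value v in w (0 if absent)
pos : ℕ → List ℕ → ℕ
pos v [] = 0
pos v (x ∷ xs) = if v ≡ᵇ x then 1 else suc (pos v xs)

Triple : Set
Triple = ℕ × ℕ × ℕ

isTriple : List ℕ → Triple → Bool
isTriple w (x , y , z) =
  (x <ᵇ y) ∧ (y <ᵇ z) ∧ (pos z w <ᵇ pos y w) ∧ (pos y w <ᵇ pos x w)

filterᵇ : {A : Set} → (A → Bool) → List A → List A
filterᵇ f [] = []
filterᵇ f (x ∷ xs) = if f x then x ∷ filterᵇ f xs else filterᵇ f xs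

allTriples : ℕ → List Triple
allTriples n =
  concatMap (λ x → concatMap (λ y → map (λ z → (x , y , z)) (idWord n)) (idWord n)) (idWord n)

T : ℕ → List ℕ → List Triple
T n w = filterᵇ (isTriple w) (allTriples n)

Γ : ℕ → List ℕ → Triple → ℕ
Γ n a (x , y , z) = if P n a z y <ᵇ P n a y x then 1 else 0

tt : ℕ → List ℕ → List ℕ → List ℕ → ℕ
tt n w a b = length (filterᵇ (λ τ → not (Γ n a τ ≡ᵇ Γ n b τ)) (T n w))

-- smallest descent (1-based), 0 if none
firstDescent : List ℕ → ℕ
firstDescent (x ∷ y ∷ xs) = if y <ᵇ x then 1 else suc (firstDescent (y ∷ xs))
firstDescent _ = 0

-- largest descent (1-based), 0 if none
lastDescent : List ℕ → ℕ
lastDescent (x ∷ y ∷ xs) with lastDescent (y ∷ xs)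
... | zero  = if y <ᵇ x then 1 else 0
... | suc k = suc (suc k)
lastDescent _ = 0

descents : (List ℕ → ℕ) → ℕ → List ℕ → List ℕ
descents choose zero    u = []
descents choose (suc k) u = choose u ∷ descents choose k (swapAt (choose u) u)

amin : List ℕ → List ℕ
amin w = reverse (descents firstDescent (inv w) w)

amax : List ℕ → List ℕ
amax w = reverse (descents lastDescent (inv w) w)

t : ℕ → List ℕ → List ℕ → ℕ
t n w a = tt n w (amin w) a

data Comm : List ℕ → List ℕ → Set where
  comm : ∀ u v i j → (i + 2 ≤ j ⊎ j + 2 ≤ i) →
         Comm (u ++ i ∷ j ∷ v) (u ++ j ∷ i ∷ v)

data Braid : List ℕ → List ℕ → Set where
  braidUp   : ∀ u v i → Braid (u ++ i ∷ suc i ∷ i ∷ v) (u ++ suc i ∷ i ∷ suc i ∷ v)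
  braidDown : ∀ u v i → Braid (u ++ suc i ∷ i ∷ suc i ∷ v) (u ++ i ∷ suc i ∷ i ∷ v)

_∼_ : List ℕ → List ℕ → Set
_∼_ = Star Comm

Cover : ℕ → List ℕ → List ℕ → List ℕ → Set
Cover n w a b = ∃[ a' ] ∃[ b' ] (a ∼ a' × b ∼ b' × Braid a' b' × t n w b' ≡ suc (t n w a'))

Lt : ℕ → List ℕ → List ℕ → List ℕ → Set
Lt n w = TransClosure (Cover n w)

_≈C_ : {n : ℕ} {w : List ℕ} → RW n w → RW n w → Set
a ≈C b = proj₁ a ∼ proj₁ b

_<C_ : {n : ℕ} {w : List ℕ} → RW n w → RW n w → Set
_<C_ {n} {w} a b = Lt n w (proj₁ a) (proj₁ b)

_≤C_ : {n : ℕ} {w : List ℕ} → RW n w → RW n w → Set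
a ≤C b = a ≈C b ⊎ a <C b

CoversC : {n : ℕ} {w : List ℕ} → RW n w → RW n w → Set
CoversC {n} {w} a b = a <C b × ¬ (Σ (RW n w) λ c → a <C c × c <C b)

-- Write Γ_a for the vector (Γ(a,τ))_τ indexed by the triples τ ∈ T_w. A commutation exchanges
-- the labels of two inversions sharing no value, so Γ_a, and hence t(a), is constant on
-- commutation classes. A long braid move at values α < β < γ reverses the order of the three
-- labels of (β,α), (γ,α), (γ,β) and changes nothing else, so it flips Γ exactly at (α,β,γ).
-- Since Γ(a_min,τ) = 0 for every triple, t(a) is the number of triples with Γ(a,τ) = 1; a cover
-- therefore raises t by one, t is strictly monotone along the closure, and the relation is a
-- partial order whose covers are exactly the generating relations.
--
-- For the extremes, let c choose the first (resp. last) descent and let greedy_c(w) be the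
-- reduced word built by repeatedly undoing c. By induction on ℓ(w), splitting off the last
-- letter k of a reduced word: if k = c(w), or k is far from c(w), the word commutes to one
-- ending in c(w) and the induction hypothesis applies; if k is adjacent to c(w), the word commutes
-- to one ending in k c(w) k, and that long braid move lowers the number of triples with Γ = 1
-- (resp. Γ = 0). Hence every class other than [a_min] covers a smaller one, and every class
-- other than [a_max] is covered by a larger one.

module Submission where

open import Defs
import Algebra.Properties.CommutativeSemigroup as CommutativeSemigroupProperties
open import Data.Bool using (Bool; true; false; if_then_else_; _∧_; not) renaming (T to Tb)
open import Data.Empty using (⊥; ⊥-elim)
open import Data.List using (List; []; _∷_; _++_; _∷ʳ_; map; length; reverse; concatMap; applyUpTo;
  initLast; _∷ʳ′_)
open import Data.List.Properties using (++-assoc; length-++; unfold-reverse)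
open import Data.List.Membership.Propositional using (_∈_)
open import Data.List.Relation.Binary.Permutation.Propositional using (_↭_; ↭-sym)
import Data.List.Relation.Binary.Permutation.Propositional as ↭
open import Data.List.Relation.Binary.Permutation.Propositional.Properties using
  (All-resp-↭; ∈-resp-↭; ↭-length)
open import Data.List.Relation.Unary.All using (All; []; _∷_)
import Data.List.Relation.Unary.All as All
open import Data.List.Relation.Unary.All.Properties using (++⁺; ++⁻)
import Data.List.Relation.Unary.All.Properties as Allₚ
open import Data.List.Relation.Unary.AllPairs using ([]; _∷_)
open import Data.List.Relation.Unary.Any using (here; there)
open import Data.List.Relation.Unary.Unique.Propositional using (Unique)
import Data.List.Relation.Unary.Unique.Propositional.Properties as Unique
open import Data.Nat
open import Data.Nat.Properties
open import Data.Nat.Tactic.RingSolver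
open import Data.Product using (Σ; ∃₂; _×_; _,_; proj₁; proj₂)
open import Data.Product.Properties using (≡-dec)
open import Data.Sum using (_⊎_; inj₁; inj₂)
import Data.Sum
open import Data.Unit using (⊤) renaming (tt to unit)
open import Relation.Binary.Construct.Closure.ReflexiveTransitive using (ε; _◅_; _◅◅_)
open import Relation.Binary.Construct.Closure.Transitive using ([_]; _∷_)
open import Relation.Binary.Definitions using (tri<; tri≈; tri>)
open import Relation.Binary.PropositionalEquality
open import Relation.Binary.Structures using (IsPartialOrder)
open import Relation.Nullary using (¬_; Dec; yes; no)
open import Relation.Nullary.Decidable using (_×-dec_)

open CommutativeSemigroupProperties +-commutativeSemigroup using (x∙yz≈y∙xz; interchange)

-- Words and adjacent transpositions

-- Positions are 1-based, as for the letters of a word; get is 0 off the list.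

get : ℕ → List ℕ → ℕ
get zero xs = 0
get (suc k) [] = 0
get (suc zero) (x ∷ xs) = x
get (suc (suc k)) (x ∷ xs) = get (suc k) xs

InBounds : ℕ → List ℕ → Set
InBounds k u = 1 ≤ k × k ≤ length u

length-swapAt : ∀ i u → length (swapAt i u) ≡ length u
length-swapAt zero u = refl
length-swapAt (suc zero) [] = refl
length-swapAt (suc zero) (x ∷ []) = refl
length-swapAt (suc zero) (x ∷ y ∷ u) = refl
length-swapAt (suc (suc i)) [] = refl
length-swapAt (suc (suc i)) (x ∷ u) = cong suc (length-swapAt (suc i) u)

get-swapAt-fst : ∀ j u → 2 + j ≤ length u → get (suc j) (swapAt (suc j) u) ≡ get (2 + j) u
get-swapAt-fst zero (x ∷ []) (s≤s ())
get-swapAt-fst zero (x ∷ y ∷ u) h = refl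
get-swapAt-fst (suc j) (x ∷ u) (s≤s h) = get-swapAt-fst j u h

get-swapAt-snd : ∀ j u → 2 + j ≤ length u → get (2 + j) (swapAt (suc j) u) ≡ get (suc j) u
get-swapAt-snd zero (x ∷ []) (s≤s ())
get-swapAt-snd zero (x ∷ y ∷ u) h = refl
get-swapAt-snd (suc j) (x ∷ u) (s≤s h) = get-swapAt-snd j u h

get-swapAt-other : ∀ j k u → k ≢ suc j → k ≢ 2 + j → get k (swapAt (suc j) u) ≡ get k u
get-swapAt-other j zero u h1 h2 = refl
get-swapAt-other zero (suc zero) u h1 h2 = ⊥-elim (h1 refl)
get-swapAt-other zero (suc (suc zero)) u h1 h2 = ⊥-elim (h2 refl)
get-swapAt-other zero (suc (suc (suc k))) [] h1 h2 = refl
get-swapAt-other zero (suc (suc (suc k))) (x ∷ []) h1 h2 = refl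
get-swapAt-other zero (suc (suc (suc k))) (x ∷ y ∷ u) h1 h2 = refl
get-swapAt-other (suc j) (suc k) [] h1 h2 = refl
get-swapAt-other (suc j) (suc zero) (x ∷ u) h1 h2 = refl
get-swapAt-other (suc j) (suc (suc k)) (x ∷ u) h1 h2 =
  get-swapAt-other j (suc k) u (λ e → h1 (cong suc e)) (λ e → h2 (cong suc e))

swapAt-beyond : ∀ j u → length u < 2 + j → swapAt (suc j) u ≡ u
swapAt-beyond zero [] h = refl
swapAt-beyond zero (x ∷ []) h = refl
swapAt-beyond zero (x ∷ y ∷ u) (s≤s (s≤s ()))
swapAt-beyond (suc j) [] h = refl
swapAt-beyond (suc j) (x ∷ u) (s≤s h) = cong (x ∷_) (swapAt-beyond j u h)

swapAt-involutive : ∀ i u → swapAt i (swapAt i u) ≡ u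
swapAt-involutive zero u = refl
swapAt-involutive (suc zero) [] = refl
swapAt-involutive (suc zero) (x ∷ []) = refl
swapAt-involutive (suc zero) (x ∷ y ∷ u) = refl
swapAt-involutive (suc (suc i)) [] = refl
swapAt-involutive (suc (suc i)) (x ∷ u) = cong (x ∷_) (swapAt-involutive (suc i) u)

get-extensionality : ∀ u v → length u ≡ length v → (∀ k → get k u ≡ get k v) → u ≡ v
get-extensionality [] [] e h = refl
get-extensionality (x ∷ u) (y ∷ v) e h =
  cong₂ _∷_ (h 1) (get-extensionality u v (suc-injective e) (λ { zero → refl ; (suc k) → h (suc (suc k)) }))

get-beyond : ∀ k u → length u < k → get k u ≡ 0
get-beyond (suc k) [] h = refl
get-beyond (suc zero) (x ∷ u) (s≤s ())
get-beyond (suc (suc k)) (x ∷ u) (s≤s h) = get-beyond (suc k) u h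

swapAt-comm : ∀ i j u → 2 + i ≤ j → swapAt i (swapAt j u) ≡ swapAt j (swapAt i u)
swapAt-comm zero j u h = refl
swapAt-comm (suc zero) (suc zero) u (s≤s ())
swapAt-comm (suc zero) (suc (suc zero)) u (s≤s (s≤s ()))
swapAt-comm (suc (suc i)) (suc zero) u (s≤s ())
swapAt-comm (suc (suc i)) (suc (suc zero)) u (s≤s (s≤s ()))
swapAt-comm (suc zero) (suc (suc (suc j))) [] h = refl
swapAt-comm (suc zero) (suc (suc (suc j))) (x ∷ []) h = refl
swapAt-comm (suc zero) (suc (suc (suc j))) (x ∷ y ∷ u) h = refl
swapAt-comm (suc (suc i)) (suc (suc (suc j))) [] h = refl
swapAt-comm (suc (suc i)) (suc (suc (suc j))) (x ∷ u) (s≤s h) = cong (x ∷_)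
  (swapAt-comm (suc i) (suc (suc j)) u h)

Far : ℕ → ℕ → Set
Far i j = 2 + i ≤ j ⊎ 2 + j ≤ i

Far-sym : ∀ {i j} → Far i j → Far j i
Far-sym = Data.Sum.swap

Far⇒gap : ∀ {i j} → Far i j → i + 2 ≤ j ⊎ j + 2 ≤ i
Far⇒gap {i} {j} (inj₁ h) = inj₁ (subst (_≤ j) (+-comm 2 i) h)
Far⇒gap {i} {j} (inj₂ h) = inj₂ (subst (_≤ i) (+-comm 2 j) h)

gap⇒Far : ∀ {i j} → i + 2 ≤ j ⊎ j + 2 ≤ i → Far i j
gap⇒Far {i} {j} (inj₁ h) = inj₁ (subst (_≤ j) (+-comm i 2) h)
gap⇒Far {i} {j} (inj₂ h) = inj₂ (subst (_≤ i) (+-comm j 2) h)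

swapAt-comm-far : ∀ i j u → Far i j → swapAt i (swapAt j u) ≡ swapAt j (swapAt i u)
swapAt-comm-far i j u (inj₁ h) = swapAt-comm i j u h
swapAt-comm-far i j u (inj₂ h) = sym (swapAt-comm j i u h)

swapAt-braid : ∀ i u → 3 + i ≤ length u →
  swapAt (suc i) (swapAt (2 + i) (swapAt (suc i) u)) ≡ swapAt (2 + i) (swapAt (suc i) (swapAt (2 + i) u))
swapAt-braid zero (x ∷ []) (s≤s ())
swapAt-braid zero (x ∷ y ∷ []) (s≤s (s≤s ()))
swapAt-braid zero (x ∷ y ∷ z ∷ u) h = refl
swapAt-braid (suc i) (x ∷ u) (s≤s h) = cong (x ∷_) (swapAt-braid i u h)

act-++ : ∀ u a b → act u (a ++ b) ≡ act (act u a) b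
act-++ u [] b = refl
act-++ u (i ∷ a) b = act-++ (swapAt i u) a b

get-∷ : ∀ x u k → 1 ≤ k → get (suc k) (x ∷ u) ≡ get k u
get-∷ x u (suc k) h = refl

≡ᵇ-refl : ∀ m → (m ≡ᵇ m) ≡ true
≡ᵇ-refl zero = refl
≡ᵇ-refl (suc m) = ≡ᵇ-refl m

≢⇒≡ᵇ-false : ∀ m n → m ≢ n → (m ≡ᵇ n) ≡ false
≢⇒≡ᵇ-false zero zero h = ⊥-elim (h refl)
≢⇒≡ᵇ-false zero (suc n) h = refl
≢⇒≡ᵇ-false (suc m) zero h = refl
≢⇒≡ᵇ-false (suc m) (suc n) h = ≢⇒≡ᵇ-false m n (λ e → h (cong suc e))

≡ᵇ-true⇒≡ : ∀ m n → (m ≡ᵇ n) ≡ true → m ≡ n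
≡ᵇ-true⇒≡ m n e = ≡ᵇ⇒≡ m n (subst Tb (sym e) _)

<⇒<ᵇ-true : ∀ m n → m < n → (m <ᵇ n) ≡ true
<⇒<ᵇ-true zero (suc n) h = refl
<⇒<ᵇ-true (suc m) (suc n) (s≤s h) = <⇒<ᵇ-true m n h

≥⇒<ᵇ-false : ∀ m n → n ≤ m → (m <ᵇ n) ≡ false
≥⇒<ᵇ-false m zero h = refl
≥⇒<ᵇ-false (suc m) (suc n) (s≤s h) = ≥⇒<ᵇ-false m n h

<ᵇ-true⇒< : ∀ m n → (m <ᵇ n) ≡ true → m < n
<ᵇ-true⇒< m n e = <ᵇ⇒< m n (subst Tb (sym e) _)

true≢false : true ≢ false
true≢false ()

Distinct : List ℕ → Set
Distinct u = ∀ j k → InBounds j u → InBounds k u → get j u ≡ get k u → j ≡ k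

Occurs : ℕ → List ℕ → Set
Occurs v u = Σ ℕ λ k → InBounds k u × get k u ≡ v

Distinct-tail : ∀ x u → Distinct (x ∷ u) → Distinct u
Distinct-tail x u d (suc j) (suc k) (_ , hj) (_ , hk) e =
  suc-injective (d (suc (suc j)) (suc (suc k)) (s≤s z≤n , s≤s hj) (s≤s z≤n , s≤s hk) e)

get-pos : ∀ v u → Occurs v u → get (pos v u) u ≡ v × InBounds (pos v u) u
get-pos v [] (suc k , (_ , ()) , _)
get-pos v (x ∷ u) (k , ik , gk) with v ≡ᵇ x in eq
... | true = sym (≡ᵇ-true⇒≡ v x eq) , (s≤s z≤n , s≤s z≤n)
get-pos v (x ∷ u) (suc zero , ik , gk) | false =
  ⊥-elim (true≢false (trans (sym (≡ᵇ-refl x)) (subst (λ z → (z ≡ᵇ x) ≡ false) (sym gk) eq)))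
get-pos v (x ∷ u) (suc (suc k) , (_ , s≤s ik) , gk) | false with get-pos v u (suc k , (s≤s z≤n , ik) , gk)
... | g , (p1 , ix) = trans (get-∷ x u (pos v u) p1) g , (s≤s z≤n , s≤s ix)

pos-get : ∀ u → Distinct u → ∀ k → InBounds k u → pos (get k u) u ≡ k
pos-get (x ∷ u) d (suc zero) ik rewrite ≡ᵇ-refl x = refl
pos-get (x ∷ u) d (suc (suc k)) (_ , s≤s ik) with get (suc k) u ≡ᵇ x in eq
... | true = ⊥-elim (1+n≢0 (suc-injective
    (d (suc (suc k)) 1 (s≤s z≤n , s≤s ik) (s≤s z≤n , s≤s z≤n) (≡ᵇ-true⇒≡ _ _ eq))))
... | false = cong suc (pos-get u (Distinct-tail x u d) (suc k) (s≤s z≤n , ik))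

-- The action of swapAt (suc j) on positions.

σ : ℕ → ℕ → ℕ
σ j k = if k ≡ᵇ suc j then 2 + j else (if k ≡ᵇ 2 + j then suc j else k)

σ-fst : ∀ j → σ j (suc j) ≡ 2 + j
σ-fst j rewrite ≡ᵇ-refl j = refl

σ-snd : ∀ j → σ j (2 + j) ≡ suc j
σ-snd j rewrite ≢⇒≡ᵇ-false (2 + j) (suc j) (λ e → 1+n≢n (suc-injective e)) | ≡ᵇ-refl j = refl

σ-other : ∀ j k → k ≢ suc j → k ≢ 2 + j → σ j k ≡ k
σ-other j k h1 h2 rewrite ≢⇒≡ᵇ-false k (suc j) h1 | ≢⇒≡ᵇ-false k (2 + j) h2 = refl

data σView (j k : ℕ) : Set where
  at-fst : k ≡ suc j → σView j k
  at-snd : k ≡ 2 + j → σView j k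
  elsewhere : k ≢ suc j → k ≢ 2 + j → σView j k

σview : ∀ j k → σView j k
σview j k with k ≟ suc j | k ≟ 2 + j
... | yes p | _ = at-fst p
... | no _ | yes q = at-snd q
... | no p | no q = elsewhere p q

σ-involutive : ∀ j k → σ j (σ j k) ≡ k
σ-involutive j k with σview j k
... | at-fst refl rewrite σ-fst j = σ-snd j
... | at-snd refl rewrite σ-snd j = σ-fst j
... | elsewhere p q rewrite σ-other j k p q = σ-other j k p q

σ-InBounds : ∀ j k u → 2 + j ≤ length u → InBounds k u → InBounds (σ j k) u
σ-InBounds j k u v ik with σview j k
... | at-fst refl rewrite σ-fst j = s≤s z≤n , v
... | at-snd refl rewrite σ-snd j = s≤s z≤n , ≤-trans (n≤1+n _) v
... | elsewhere p q rewrite σ-other j k p q = ik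

get-swapAt : ∀ j k u → 2 + j ≤ length u → get k (swapAt (suc j) u) ≡ get (σ j k) u
get-swapAt j k u v with σview j k
... | at-fst refl rewrite σ-fst j = get-swapAt-fst j u v
... | at-snd refl rewrite σ-snd j = get-swapAt-snd j u v
... | elsewhere p q rewrite σ-other j k p q = get-swapAt-other j k u p q

InBounds-swapAt : ∀ i k u → InBounds k u → InBounds k (swapAt i u)
InBounds-swapAt i k u (a , b) = a , subst (k ≤_) (sym (length-swapAt i u)) b

InBounds-swapAt⁻ : ∀ i k u → InBounds k (swapAt i u) → InBounds k u
InBounds-swapAt⁻ i k u (a , b) = a , subst (k ≤_) (length-swapAt i u) b

Distinct-swapAt : ∀ i u → Distinct u → Distinct (swapAt i u)
Distinct-swapAt zero u d = d
Distinct-swapAt (suc j) u d with 2 + j ≤? length u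
... | no nv rewrite swapAt-beyond j u (≰⇒> nv) = d
... | yes v = λ a b ia ib e →
  let ia0 = InBounds-swapAt⁻ (suc j) a u ia
      ib0 = InBounds-swapAt⁻ (suc j) b u ib
      e0 = trans (sym (get-swapAt j a u v)) (trans e (get-swapAt j b u v))
  in trans (sym (σ-involutive j a)) (trans (cong (σ j) (d _ _ (σ-InBounds j a u v ia0) (σ-InBounds j b u v ib0) e0)) (σ-involutive j b))

Occurs-swapAt : ∀ i v u → Occurs v u → Occurs v (swapAt i u)
Occurs-swapAt zero v u m = m
Occurs-swapAt (suc j) v u m with 2 + j ≤? length u
... | no nv rewrite swapAt-beyond j u (≰⇒> nv) = m
... | yes vv = σ j (proj₁ m) , InBounds-swapAt (suc j) (σ j (proj₁ m)) u
    (σ-InBounds j (proj₁ m) u vv (proj₁ (proj₂ m))) ,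
               trans (get-swapAt j (σ j (proj₁ m)) u vv)
                 (trans (cong (λ z → get z u) (σ-involutive j (proj₁ m))) (proj₂ (proj₂ m)))

Occurs-swapAt⁻ : ∀ i v u → Occurs v (swapAt i u) → Occurs v u
Occurs-swapAt⁻ i v u m = subst (Occurs v) (swapAt-involutive i u) (Occurs-swapAt i v (swapAt i u) m)

pos-swapAt : ∀ j v u → Distinct u → Occurs v u → 2 + j ≤ length u → pos v (swapAt (suc j) u) ≡ σ j (pos v u)
pos-swapAt j v u d m vv =
  let g , ix = get-pos v u m
      ix2 = InBounds-swapAt (suc j) (σ j (pos v u)) u (σ-InBounds j (pos v u) u vv ix)
      e = trans (get-swapAt j (σ j (pos v u)) u vv)
        (trans (cong (λ z → get z u) (σ-involutive j (pos v u))) g)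
  in trans (cong (λ z → pos z (swapAt (suc j) u)) (sym e)) (pos-get (swapAt (suc j) u) (Distinct-swapAt (suc j) u d) (σ j (pos v u)) ix2)

-- Inversions and reduced words

bit : Bool → ℕ
bit true = 1
bit false = 0

if-suc≡bit+ : ∀ b c → (if b then suc c else c) ≡ bit b + c
if-suc≡bit+ true c = refl
if-suc≡bit+ false c = refl

countLess-swapAt : ∀ x i xs → countLess x (swapAt i xs) ≡ countLess x xs
countLess-swapAt x zero xs = refl
countLess-swapAt x (suc zero) [] = refl
countLess-swapAt x (suc zero) (y ∷ []) = refl
countLess-swapAt x (suc zero) (y ∷ z ∷ xs) rewrite if-suc≡bit+ (z <ᵇ x)
  (if y <ᵇ x then suc (countLess x xs) else countLess x xs)
  | if-suc≡bit+ (y <ᵇ x) (countLess x xs) | if-suc≡bit+ (y <ᵇ x)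
    (if z <ᵇ x then suc (countLess x xs) else countLess x xs)
  | if-suc≡bit+ (z <ᵇ x) (countLess x xs) = x∙yz≈y∙xz (bit (z <ᵇ x)) (bit (y <ᵇ x)) (countLess x xs)
countLess-swapAt x (suc (suc i)) [] = refl
countLess-swapAt x (suc (suc i)) (y ∷ xs) rewrite countLess-swapAt x (suc i) xs = refl

inv-swapAt : ∀ j u → 2 + j ≤ length u →
  inv (swapAt (suc j) u) + bit (get (2 + j) u <ᵇ get (suc j) u) ≡ inv u + bit (get (suc j) u <ᵇ get (2 + j) u)
inv-swapAt zero (x ∷ []) (s≤s ())
inv-swapAt zero (x ∷ y ∷ xs) h rewrite if-suc≡bit+ (x <ᵇ y) (countLess y xs) | if-suc≡bit+ (y <ᵇ x)
  (countLess x xs) =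
  rearrange (bit (x <ᵇ y)) (bit (y <ᵇ x)) (countLess y xs) (countLess x xs) (inv xs)
  where
  rearrange : ∀ a b c d e → a + c + (d + e) + b ≡ b + d + (c + e) + a
  rearrange = solve-∀
inv-swapAt (suc j) (x ∷ xs) (s≤s h) rewrite countLess-swapAt x (suc j) xs =
  trans (+-assoc (countLess x xs) _ _) (trans (cong (countLess x xs +_) (inv-swapAt j xs h))
    (sym (+-assoc (countLess x xs) _ _)))

Ascent : ℕ → List ℕ → Set
Ascent zero u = ⊥
Ascent (suc j) u = 2 + j ≤ length u × get (suc j) u < get (2 + j) u

Descent : ℕ → List ℕ → Set
Descent zero u = ⊥
Descent (suc j) u = 2 + j ≤ length u × get (2 + j) u < get (suc j) u

RedFrom : List ℕ → List ℕ → Set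
RedFrom u [] = ⊤
RedFrom u (i ∷ a) = Ascent i u × RedFrom (swapAt i u) a

Distinct-adjacent : ∀ j u → Distinct u → 2 + j ≤ length u → get (suc j) u ≢ get (2 + j) u
Distinct-adjacent j u d v e = 1+n≢n (sym (d (suc j) (2 + j) (s≤s z≤n , ≤-trans (n≤1+n _) v) (s≤s z≤n , v) e))

inv-swapAt-ascent : ∀ i u → Ascent i u → inv (swapAt i u) ≡ suc (inv u)
inv-swapAt-ascent (suc j) u (v , lt) with inv-swapAt j u v
... | e rewrite <⇒<ᵇ-true _ _ lt | ≥⇒<ᵇ-false (get (2 + j) u) (get (suc j) u) (<⇒≤ lt) =
  trans (sym (+-identityʳ _)) (trans e (+-comm (inv u) 1))

inv-swapAt-descent : ∀ i u → Descent i u → suc (inv (swapAt i u)) ≡ inv u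
inv-swapAt-descent (suc j) u (v , lt) with inv-swapAt j u v
... | e rewrite <⇒<ᵇ-true _ _ lt | ≥⇒<ᵇ-false (get (suc j) u) (get (2 + j) u) (<⇒≤ lt) =
  trans (+-comm 1 _) (trans e (+-identityʳ _))

ascent⊎descent : ∀ j u → Distinct u → 2 + j ≤ length u → Ascent (suc j) u ⊎ Descent (suc j) u
ascent⊎descent j u d v with <-cmp (get (suc j) u) (get (2 + j) u)
... | tri< a _ _ = inj₁ (v , a)
... | tri≈ _ b _ = ⊥-elim (Distinct-adjacent j u d v b)
... | tri> _ _ c = inj₂ (v , c)

2+n≢n : ∀ n → suc (suc n) ≢ n
2+n≢n zero ()
2+n≢n (suc n) e = 2+n≢n n (suc-injective e)

n≢1+n : ∀ {n} → n ≢ suc n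
n≢1+n e = 1+n≢n (sym e)

n≢2+n : ∀ {n} → n ≢ 2 + n
n≢2+n e = 2+n≢n _ (sym e)

inv-swapAt-≤ : ∀ i u → Distinct u →
  inv (swapAt i u) ≤ suc (inv u) × (inv (swapAt i u) ≡ suc (inv u) → Ascent i u)
inv-swapAt-≤ zero u d = n≤1+n _ , λ e → ⊥-elim (1+n≢n (sym e))
inv-swapAt-≤ (suc j) u d with 2 + j ≤? length u
... | no nv rewrite swapAt-beyond j u (≰⇒> nv) = n≤1+n _ , λ e → ⊥-elim (1+n≢n (sym e))
... | yes v with ascent⊎descent j u d v
...   | inj₁ a = ≤-reflexive (inv-swapAt-ascent (suc j) u a) , λ _ → a
...   | inj₂ b = ≤-trans (≤-trans (n≤1+n _) (≤-reflexive (inv-swapAt-descent (suc j) u b))) (n≤1+n _) ,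
                 λ e → ⊥-elim (2+n≢n _ (trans (cong suc (sym e)) (inv-swapAt-descent (suc j) u b)))

inv-act-≤ : ∀ u a → Distinct u → inv (act u a) ≤ inv u + length a
inv-act-≤ u [] d = ≤-reflexive (sym (+-identityʳ _))
inv-act-≤ u (i ∷ a) d = ≤-trans (inv-act-≤ (swapAt i u) a (Distinct-swapAt i u d))
  (≤-trans (+-monoˡ-≤ (length a) (proj₁ (inv-swapAt-≤ i u d))) (≤-reflexive (sym (+-suc _ _))))

inv-act⇒RedFrom : ∀ u a → Distinct u → inv (act u a) ≡ inv u + length a → RedFrom u a
inv-act⇒RedFrom u [] d e = unit
inv-act⇒RedFrom u (i ∷ a) d e with inv-swapAt-≤ i u d
... | le , f with inv (swapAt i u) ≟ suc (inv u)
...   | yes p = f p , inv-act⇒RedFrom (swapAt i u) a (Distinct-swapAt i u d)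
    (trans e (trans (+-suc _ _) (cong (_+ length a) (sym p))))
...   | no np = ⊥-elim (1+n≰n (subst (_≤ inv u + length a) (trans e (+-suc _ _))
          (≤-trans (inv-act-≤ (swapAt i u) a (Distinct-swapAt i u d)) (+-monoˡ-≤ (length a) (lemLE le np)))))
  where
  lemLE : ∀ {m n} → m ≤ suc n → m ≢ suc n → m ≤ n
  lemLE {m} {n} p q with m≤n⇒m<n∨m≡n p
  ... | inj₁ (s≤s r) = r
  ... | inj₂ r = ⊥-elim (q r)

RedFrom⇒inv-act : ∀ u a → RedFrom u a → inv (act u a) ≡ inv u + length a
RedFrom⇒inv-act u [] r = sym (+-identityʳ _)
RedFrom⇒inv-act u (i ∷ a) (asc , r) = trans (RedFrom⇒inv-act (swapAt i u) a r)
  (trans (cong (_+ length a) (inv-swapAt-ascent i u asc)) (sym (+-suc _ _)))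

RedFrom-++⁻ : ∀ u a b → RedFrom u (a ++ b) → RedFrom u a × RedFrom (act u a) b
RedFrom-++⁻ u [] b r = unit , r
RedFrom-++⁻ u (i ∷ a) b (x , r) = (x , proj₁ (RedFrom-++⁻ (swapAt i u) a b r)) , proj₂
  (RedFrom-++⁻ (swapAt i u) a b r)

RedFrom-++⁺ : ∀ u a b → RedFrom u a → RedFrom (act u a) b → RedFrom u (a ++ b)
RedFrom-++⁺ u [] b r s = s
RedFrom-++⁺ u (i ∷ a) b (x , r) s = x , RedFrom-++⁺ (swapAt i u) a b r s

-- The canonical labelling

Inversion : ℕ → ℕ → List ℕ → Set
Inversion p q u = q < p × Occurs p u × Occurs q u × pos p u < pos q u

σ-monotone : ∀ j a b → a < b → (a ≡ suc j → b ≡ 2 + j → ⊥) → σ j a < σ j b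
σ-monotone j a b lt ex with σview j a | σview j b
... | at-fst refl | at-fst refl = ⊥-elim (<-irrefl refl lt)
... | at-fst refl | at-snd refl = ⊥-elim (ex refl refl)
... | at-fst refl | elsewhere p q rewrite σ-fst j | σ-other j b p q = lemA
  where
  lemA : 2 + j < b
  lemA with m≤n⇒m<n∨m≡n lt
  ... | inj₁ r = r
  ... | inj₂ r = ⊥-elim (q (sym r))
... | at-snd refl | at-fst refl = ⊥-elim (<-asym lt (n<1+n _))
... | at-snd refl | at-snd refl = ⊥-elim (<-irrefl refl lt)
... | at-snd refl | elsewhere p q rewrite σ-snd j | σ-other j b p q = <-trans (n<1+n _) lt
... | elsewhere p q | at-fst refl rewrite σ-fst j | σ-other j a p q = <-trans lt (n<1+n _)
... | elsewhere p q | at-snd refl rewrite σ-snd j | σ-other j a p q = lemB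
  where
  lemB : a < suc j
  lemB with m≤n⇒m<n∨m≡n (≤-pred lt)
  ... | inj₁ r = r
  ... | inj₂ r = ⊥-elim (p r)
... | elsewhere p q | elsewhere p2 q2 rewrite σ-other j a p q | σ-other j b p2 q2 = lt

Distinct-act : ∀ u a → Distinct u → Distinct (act u a)
Distinct-act u [] d = d
Distinct-act u (i ∷ a) d = Distinct-act (swapAt i u) a (Distinct-swapAt i u d)

Occurs-act⁻ : ∀ v u a → Occurs v (act u a) → Occurs v u
Occurs-act⁻ v u [] m = m
Occurs-act⁻ v u (i ∷ a) m = Occurs-swapAt⁻ i v u (Occurs-act⁻ v (swapAt i u) a m)

length-act : ∀ u a → length (act u a) ≡ length u
length-act u [] = refl
length-act u (i ∷ a) = trans (length-act (swapAt i u) a) (length-swapAt i u)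

get-Occurs : ∀ k u → InBounds k u → Occurs (get k u) u
get-Occurs k u ik = k , ik , refl

Inversion-swapAt : ∀ i u p q → Distinct u → Ascent i u → Inversion p q u → Inversion p q (swapAt i u)
Inversion-swapAt (suc j) u p q d (v , lt) (qp , mp , mq , pp) =
  qp , Occurs-swapAt (suc j) p u mp , Occurs-swapAt (suc j) q u mq ,
  subst₂ _<_ (sym (pos-swapAt j p u d mp v)) (sym (pos-swapAt j q u d mq v))
    (σ-monotone j (pos p u) (pos q u) pp λ e1 e2 →
      <-asym qp (subst₂ _<_ (trans (cong (λ z → get z u) (sym e1)) (proj₁ (get-pos p u mp)))
                            (trans (cong (λ z → get z u) (sym e2)) (proj₁ (get-pos q u mq))) lt))

Inversion-act : ∀ u a p q → Distinct u → RedFrom u a → Inversion p q u → Inversion p q (act u a)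
Inversion-act u [] p q d r h = h
Inversion-act u (i ∷ a) p q d (x , r) h = Inversion-act (swapAt i u) a p q (Distinct-swapAt i u d) r
  (Inversion-swapAt i u p q d x h)

swappedPair-inBounds : ∀ j u → 2 + j ≤ length u →
  swappedPair (suc j) u ≡ (if get (2 + j) u <ᵇ get (suc j) u then (get (suc j) u , get (2 + j) u) else
    (get (2 + j) u , get (suc j) u))
swappedPair-inBounds zero (x ∷ []) (s≤s ())
swappedPair-inBounds zero (x ∷ y ∷ u) h = refl
swappedPair-inBounds (suc j) (x ∷ u) (s≤s h) = swappedPair-inBounds j u h

swappedPair-beyond : ∀ j u → length u < 2 + j → swappedPair (suc j) u ≡ (0 , 0)
swappedPair-beyond zero [] h = refl
swappedPair-beyond zero (x ∷ []) h = refl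
swappedPair-beyond zero (x ∷ y ∷ u) (s≤s (s≤s ()))
swappedPair-beyond (suc j) [] h = refl
swappedPair-beyond (suc j) (x ∷ u) (s≤s h) = swappedPair-beyond j u h

swappedPair-ascent : ∀ i u → Ascent i u → Σ ℕ λ j →
  i ≡ suc j × swappedPair i u ≡ (get (2 + j) u , get (suc j) u)
swappedPair-ascent (suc j) u (v , lt) = j , refl , trans (swappedPair-inBounds j u v)
  (cong (λ b → if b then (get (suc j) u , get (2 + j) u) else (get (2 + j) u , get (suc j) u))
    (≥⇒<ᵇ-false _ _ (<⇒≤ lt)))

swappedPair-Inversion : ∀ i u → Distinct u → Ascent i u →
  Inversion (proj₁ (swappedPair i u)) (proj₂ (swappedPair i u)) (swapAt i u)
swappedPair-Inversion (suc j) u d (v , lt) rewrite proj₂ (proj₂ (swappedPair-ascent (suc j) u (v , lt))) =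
  lt , Occurs-swapAt (suc j) _ u (get-Occurs (2 + j) u (s≤s z≤n , v)) , Occurs-swapAt (suc j) _ u
    (get-Occurs (suc j) u (s≤s z≤n , ≤-trans (n≤1+n _) v)) ,
  subst₂ _<_ (sym e1) (sym e2) (n<1+n _)
  where
  d2 = Distinct-swapAt (suc j) u d
  e1 : pos (get (2 + j) u) (swapAt (suc j) u) ≡ suc j
  e1 = trans (cong (λ z → pos z (swapAt (suc j) u)) (sym (get-swapAt-fst j u v)))
    (pos-get _ d2 (suc j) (s≤s z≤n , subst (suc j ≤_) (sym (length-swapAt (suc j) u)) (≤-trans (n≤1+n _) v) ))
  e2 : pos (get (suc j) u) (swapAt (suc j) u) ≡ 2 + j
  e2 = trans (cong (λ z → pos z (swapAt (suc j) u)) (sym (get-swapAt-snd j u v)))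
    (pos-get _ d2 (2 + j) (s≤s z≤n , subst (2 + j ≤_) (sym (length-swapAt (suc j) u)) v))

swaps-Inversion : ∀ u a → Distinct u → RedFrom u a →
  All (λ ρ → Inversion (proj₁ ρ) (proj₂ ρ) (act u a)) (swaps u a)
swaps-Inversion u [] d r = []
swaps-Inversion u (i ∷ a) d (x , r) =
  Inversion-act (swapAt i u) a _ _ (Distinct-swapAt i u d) r (swappedPair-Inversion i u d x) ∷
    swaps-Inversion (swapAt i u) a (Distinct-swapAt i u d) r

Pair : Set
Pair = ℕ × ℕ

_≡ᵇᵖ_ : Pair → Pair → Bool
(p , q) ≡ᵇᵖ (p2 , q2) = (p ≡ᵇ p2) ∧ (q ≡ᵇ q2)

≡ᵇᵖ-refl : ∀ ρ → ρ ≡ᵇᵖ ρ ≡ true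
≡ᵇᵖ-refl (p , q) rewrite ≡ᵇ-refl p | ≡ᵇ-refl q = refl

≢⇒≡ᵇᵖ-false : ∀ ρ e → ρ ≢ e → ρ ≡ᵇᵖ e ≡ false
≢⇒≡ᵇᵖ-false (p , q) (p2 , q2) h with p ≟ p2 | q ≟ q2
... | yes refl | yes refl = ⊥-elim (h refl)
... | no np | _ rewrite ≢⇒≡ᵇ-false p p2 np = refl
... | yes refl | no nq rewrite ≡ᵇ-refl p | ≢⇒≡ᵇ-false q q2 nq = refl

_≟ᵖ_ : ∀ (a b : Pair) → Dec (a ≡ b)
_≟ᵖ_ = ≡-dec _≟_ _≟_

-- indexOf reports absence as 0, so shifting an index past a prefix must keep 0 fixed.

shift : ℕ → ℕ → ℕ
shift l zero = 0
shift l (suc j) = l + suc j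

indexOf-∷ : ∀ ρ e L → indexOf ρ (e ∷ L) ≡ (if ρ ≡ᵇᵖ e then 1 else shift 1 (indexOf ρ L))
indexOf-∷ (p , q) (p2 , q2) L with (p ≡ᵇ p2) ∧ (q ≡ᵇ q2)
... | true = refl
... | false with indexOf (p , q) L
...   | zero = refl
...   | suc k = refl

indexOf-here : ∀ ρ L → indexOf ρ (ρ ∷ L) ≡ 1
indexOf-here ρ L rewrite indexOf-∷ ρ ρ L | ≡ᵇᵖ-refl ρ = refl

indexOf-there : ∀ ρ e L → ρ ≢ e → indexOf ρ (e ∷ L) ≡ shift 1 (indexOf ρ L)
indexOf-there ρ e L h rewrite indexOf-∷ ρ e L | ≢⇒≡ᵇᵖ-false ρ e h = refl

indexOf-≤-length : ∀ ρ L → indexOf ρ L ≤ length L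
indexOf-≤-length ρ [] = z≤n
indexOf-≤-length ρ (e ∷ L) rewrite indexOf-∷ ρ e L with ρ ≡ᵇᵖ e
... | true = s≤s z≤n
... | false with indexOf ρ L | indexOf-≤-length ρ L
...   | zero | _ = z≤n
...   | suc k | h = s≤s h

indexOf-absent : ∀ ρ L → All (λ e → ρ ≢ e) L → indexOf ρ L ≡ 0
indexOf-absent ρ [] [] = refl
indexOf-absent ρ (e ∷ L) (h ∷ hs) rewrite indexOf-there ρ e L h | indexOf-absent ρ L hs = refl

shift-shift : ∀ a b c → shift a (shift b c) ≡ shift (a + b) c
shift-shift a b zero = refl
shift-shift a b (suc c) rewrite +-suc b c = trans (cong (a +_) (sym (+-suc b c))) (sym (+-assoc a b (suc c)))

shift-1≡0 : ∀ n → shift 1 n ≡ 0 → n ≡ 0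
shift-1≡0 zero e = refl

indexOf-++-absent : ∀ ρ L R → indexOf ρ L ≡ 0 → indexOf ρ (L ++ R) ≡ shift (length L) (indexOf ρ R)
indexOf-++-absent ρ [] R h with indexOf ρ R
... | zero = refl
... | suc k = refl
indexOf-++-absent ρ (e ∷ L) R h with ρ ≟ᵖ e
... | yes refl = ⊥-elim (1+n≢0 (trans (sym (indexOf-here ρ L)) h))
... | no ne = trans (indexOf-there ρ e (L ++ R) ne)
    (trans (cong (shift 1) (indexOf-++-absent ρ L R h0)) (shift-shift 1 (length L) (indexOf ρ R)))
  where
  h0 : indexOf ρ L ≡ 0
  h0 = shift-1≡0 (indexOf ρ L) (trans (sym (indexOf-there ρ e L ne)) h)

indexOf-++-present : ∀ ρ L R → indexOf ρ L ≢ 0 → indexOf ρ (L ++ R) ≡ indexOf ρ L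
indexOf-++-present ρ [] R h = ⊥-elim (h refl)
indexOf-++-present ρ (e ∷ L) R h with ρ ≟ᵖ e
... | yes refl = trans (indexOf-here ρ (L ++ R)) (sym (indexOf-here ρ L))
... | no ne = trans (indexOf-there ρ e (L ++ R) ne)
    (trans (cong (shift 1) (indexOf-++-present ρ L R h0)) (sym (indexOf-there ρ e L ne)))
  where
  h0 : indexOf ρ L ≢ 0
  h0 z = h (trans (indexOf-there ρ e L ne) (cong (shift 1) z))

Outside : ℕ → ℕ → ℕ → Set
Outside s m I = I ≤ s ⊎ s + m < I

Inside : ℕ → ℕ → ℕ → Set
Inside s m I = s < I × I ≤ s + m

<ᵇ-inside-outside : ∀ s m I J K → Inside s m I → Inside s m J → Outside s m K →
  ((I <ᵇ K) ≡ (J <ᵇ K)) × ((K <ᵇ I) ≡ (K <ᵇ J))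
<ᵇ-inside-outside s m I J K (i1 , i2) (j1 , j2) (inj₁ k) =
  trans (≥⇒<ᵇ-false I K (≤-trans k (<⇒≤ i1))) (sym (≥⇒<ᵇ-false J K (≤-trans k (<⇒≤ j1)))) ,
  trans (<⇒<ᵇ-true K I (≤-<-trans k i1)) (sym (<⇒<ᵇ-true K J (≤-<-trans k j1)))
<ᵇ-inside-outside s m I J K (i1 , i2) (j1 , j2) (inj₂ k) =
  trans (<⇒<ᵇ-true I K (≤-<-trans i2 k)) (sym (<⇒<ᵇ-true J K (≤-<-trans j2 k))) ,
  trans (≥⇒<ᵇ-false K I (<⇒≤ (≤-<-trans i2 k))) (sym (≥⇒<ᵇ-false K J (<⇒≤ (≤-<-trans j2 k))))

-- Rearranging a block B (into B2) inside L ++ B ++ M does not change the relative order of two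
-- labels unless both lie in the block.

module BlockReorder (L B B2 M : List Pair) (lenB : length B2 ≡ length B)
             (hB : ∀ ρ → indexOf ρ B ≡ 0 → indexOf ρ B2 ≡ 0)
             (hB2 : ∀ ρ → indexOf ρ B2 ≡ 0 → indexOf ρ B ≡ 0) where

  S = L ++ (B ++ M)
  S2 = L ++ (B2 ++ M)
  s = length L
  m = length B

  FromBlock : Pair → Set
  FromBlock ρ = indexOf ρ L ≡ 0 × indexOf ρ B ≢ 0

  Placement : Pair → Set
  Placement ρ = (indexOf ρ S ≡ indexOf ρ S2 × Outside s m (indexOf ρ S)) ⊎
          (FromBlock ρ × Inside s m (indexOf ρ S) × Inside s m (indexOf ρ S2))

  shift-Outside : ∀ k → Outside s m (shift (s + m) k)
  shift-Outside zero = inj₁ z≤n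
  shift-Outside (suc k) = inj₂ (subst (_< s + m + suc k) (+-identityʳ _) (+-monoʳ-< (s + m) (s≤s z≤n)))

  nonzero-suc : ∀ n → n ≢ 0 → Σ ℕ λ k → n ≡ suc k
  nonzero-suc zero h = ⊥-elim (h refl)
  nonzero-suc (suc n) h = n , refl

  Inside-block : ∀ (C : List Pair) ρ → length C ≡ m → indexOf ρ C ≢ 0 → indexOf ρ L ≡ 0 →
    Inside s m (indexOf ρ (L ++ (C ++ M)))
  Inside-block C ρ lc nz z with nonzero-suc (indexOf ρ C) nz
  ... | k , e = subst (Inside s m) (sym (trans (indexOf-++-absent ρ L (C ++ M) z)
      (cong (shift s) (trans (indexOf-++-present ρ C M nz) e))))
                  (subst (_< s + suc k) (+-identityʳ _) (+-monoʳ-< s (s≤s z≤n)) ,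
                   +-monoʳ-≤ s (subst (suc k ≤_) lc (subst (_≤ length C) e (indexOf-≤-length ρ C))))

  placement : ∀ ρ → Placement ρ
  placement ρ with indexOf ρ L ≟ 0
  ... | no nz = inj₁ (trans (indexOf-++-present ρ L _ nz) (sym (indexOf-++-present ρ L _ nz)) ,
                       inj₁ (subst (_≤ s) (sym (indexOf-++-present ρ L _ nz)) (indexOf-≤-length ρ L)))
  ... | yes z with indexOf ρ B ≟ 0
  ...   | yes zb = inj₁ (trans e1 (sym e2) , subst (Outside s m) (sym e1) (shift-Outside (indexOf ρ M)))
    where
    e1 : indexOf ρ S ≡ shift (s + m) (indexOf ρ M)
    e1 = trans (indexOf-++-absent ρ L _ z) (trans (cong (shift s) (indexOf-++-absent ρ B M zb))
      (shift-shift s m (indexOf ρ M)))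
    e2 : indexOf ρ S2 ≡ shift (s + m) (indexOf ρ M)
    e2 = trans (indexOf-++-absent ρ L _ z) (trans
      (cong (shift s) (trans (indexOf-++-absent ρ B2 M (hB ρ zb)) (cong (λ l → shift l (indexOf ρ M)) lenB)))
        (shift-shift s m (indexOf ρ M)))
  ...   | no nzb = inj₂ ((z , nzb) , Inside-block B ρ refl nzb z , Inside-block B2 ρ lenB
      (λ e → nzb (hB2 ρ e)) z)

  <ᵇ-preserved : ∀ ρ1 ρ2 → ¬ (FromBlock ρ1 × FromBlock ρ2) →
    (indexOf ρ1 S <ᵇ indexOf ρ2 S) ≡ (indexOf ρ1 S2 <ᵇ indexOf ρ2 S2)
  <ᵇ-preserved ρ1 ρ2 h with placement ρ1 | placement ρ2
  ... | inj₁ (e1 , _) | inj₁ (e2 , _) rewrite e1 | e2 = refl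
  ... | inj₂ (_ , i1 , j1) | inj₁ (e2 , o2) rewrite sym e2 = proj₁ (<ᵇ-inside-outside s m _ _ _ i1 j1 o2)
  ... | inj₁ (e1 , o1) | inj₂ (_ , i2 , j2) rewrite sym e1 = proj₂ (<ᵇ-inside-outside s m _ _ _ i2 j2 o1)
  ... | inj₂ (n1 , _) | inj₂ (n2 , _) = ⊥-elim (h (n1 , n2))

-- Commutations preserve Γ and t

swaps-++ : ∀ u a b → swaps u (a ++ b) ≡ swaps u a ++ swaps (act u a) b
swaps-++ u [] b = refl
swaps-++ u (i ∷ a) b = cong (swappedPair i u ∷_) (swaps-++ (swapAt i u) a b)

far-positions : ∀ a b k → Far a b → (k ≡ a ⊎ k ≡ suc a) → (k ≢ b) × (k ≢ suc b)
far-positions a b k (inj₁ h) (inj₁ refl) = (λ { refl → 1+n≰n (≤-trans (n≤1+n _) h) }) ,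
  (λ { refl → 1+n≰n (≤-trans (n≤1+n _) (≤-trans (n≤1+n _) h)) })
far-positions a b k (inj₁ h) (inj₂ refl) = (λ { refl → 1+n≰n h }) , (λ { refl → 1+n≰n (≤-trans (n≤1+n _) h) })
far-positions a b k (inj₂ h) (inj₁ refl) = (λ { refl → 1+n≰n (≤-trans (n≤1+n _) h) }) , (λ { refl → 1+n≰n h })
far-positions a b k (inj₂ h) (inj₂ refl) = (λ { refl → 1+n≰n (≤-trans (n≤1+n _) (≤-trans (n≤1+n _) h)) }) ,
  (λ { refl → 1+n≰n (≤-trans (n≤1+n _) h) })

swappedPair-far : ∀ i j U → Far i j → swappedPair i (swapAt j U) ≡ swappedPair i U
swappedPair-far zero j U h = refl
swappedPair-far (suc a) zero U h = refl
swappedPair-far (suc a) (suc b) U h with 2 + a ≤? length U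
... | yes v = trans (swappedPair-inBounds a (swapAt (suc b) U)
    (subst (2 + a ≤_) (sym (length-swapAt (suc b) U)) v))
               (trans (cong₂ (λ p q → if q <ᵇ p then (p , q) else (q , p)) g1 g2)
                 (sym (swappedPair-inBounds a U v)))
  where
  ne : ∀ {k} → (k ≡ suc a ⊎ k ≡ 2 + a) → (k ≢ suc b) × (k ≢ 2 + b)
  ne e = far-positions (suc a) (suc b) _ h e
  g1 : get (suc a) (swapAt (suc b) U) ≡ get (suc a) U
  g1 = get-swapAt-other b (suc a) U (proj₁ (ne (inj₁ refl))) (proj₂ (ne (inj₁ refl)))
  g2 : get (2 + a) (swapAt (suc b) U) ≡ get (2 + a) U
  g2 = get-swapAt-other b (2 + a) U (proj₁ (ne (inj₂ refl))) (proj₂ (ne (inj₂ refl)))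
... | no nv = trans (swappedPair-beyond a (swapAt (suc b) U)
    (subst (_< 2 + a) (sym (length-swapAt (suc b) U)) (≰⇒> nv))) (sym (swappedPair-beyond a U (≰⇒> nv)))

SwapEntry : ℕ → List ℕ → ℕ → Set
SwapEntry i U c = Σ ℕ λ k → i ≡ suc k × 2 + k ≤ length U × (c ≡ get (suc k) U ⊎ c ≡ get (2 + k) U)

swappedPair-entries : ∀ i U →
  swappedPair i U ≡ (0 , 0) ⊎ (SwapEntry i U (proj₁ (swappedPair i U)) × SwapEntry i U
    (proj₂ (swappedPair i U)))
swappedPair-entries zero U = inj₁ refl
swappedPair-entries (suc k) U with 2 + k ≤? length U
... | no nv = inj₁ (swappedPair-beyond k U (≰⇒> nv))
... | yes v rewrite swappedPair-inBounds k U v with get (2 + k) U <ᵇ get (suc k) U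
...   | true = inj₂ ((k , refl , v , inj₁ refl) , (k , refl , v , inj₂ refl))
...   | false = inj₂ ((k , refl , v , inj₂ refl) , (k , refl , v , inj₁ refl))

SwapEntry-far-disjoint : ∀ i j U c → Distinct U → Far i j → SwapEntry i U c → SwapEntry j U c → ⊥
SwapEntry-far-disjoint i j U c d h (k , refl , v , e) (l , refl , w , f) with pp k v e | pp l w f
  where
  pp : ∀ m → 2 + m ≤ length U → (c ≡ get (suc m) U ⊎ c ≡ get (2 + m) U) → Σ ℕ λ p →
    InBounds p U × c ≡ get p U × (p ≡ suc m ⊎ p ≡ 2 + m)
  pp m x (inj₁ e) = suc m , (s≤s z≤n , ≤-trans (n≤1+n _) x) , e , inj₁ refl
  pp m x (inj₂ e) = 2 + m , (s≤s z≤n , x) , e , inj₂ refl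
... | p , ip , ep , hp | q , iq , eq , hq with d p q ip iq (trans (sym ep) eq)
... | refl with hq | far-positions (suc k) (suc l) p h hp
... | inj₁ r | (n1 , n2) = n1 r
... | inj₂ r | (n1 , n2) = n2 r

get-applyUpTo : ∀ (f : ℕ → ℕ) n k → k < n → get (suc k) (map suc (applyUpTo f n)) ≡ suc (f k)
get-applyUpTo f (suc n) zero h = refl
get-applyUpTo f (suc n) (suc k) (s≤s h) = get-applyUpTo (λ z → f (suc z)) n k h

length-applyUpTo : ∀ (f : ℕ → ℕ) n → length (map suc (applyUpTo f n)) ≡ n
length-applyUpTo f zero = refl
length-applyUpTo f (suc n) = cong suc (length-applyUpTo (λ z → f (suc z)) n)

length-idWord : ∀ n → length (idWord n) ≡ n
length-idWord n = length-applyUpTo (λ z → z) n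

get-idWord : ∀ n k → InBounds k (idWord n) → get k (idWord n) ≡ k
get-idWord n (suc k) (_ , h) = get-applyUpTo (λ z → z) n k (subst (suc k ≤_) (length-idWord n) h)

Distinct-idWord : ∀ n → Distinct (idWord n)
Distinct-idWord n j k ij ik e = trans (sym (get-idWord n j ij)) (trans e (get-idWord n k ik))

Γ-cong : ∀ n a b x y z →
  (indexOf (z , y) (swaps (idWord n) a) <ᵇ indexOf (y , x) (swaps (idWord n) a)) ≡
    (indexOf (z , y) (swaps (idWord n) b) <ᵇ indexOf (y , x) (swaps (idWord n) b)) → Γ n a (x , y , z) ≡ Γ n
      b (x , y , z)
Γ-cong n a b x y z e = cong (λ c → if c then 1 else 0) e

indexOf₂-absent : ∀ ρ a b → indexOf ρ (a ∷ b ∷ []) ≡ 0 → ρ ≢ a × ρ ≢ b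
indexOf₂-absent ρ a b h with ρ ≟ᵖ a | ρ ≟ᵖ b
... | yes refl | _ = ⊥-elim (1+n≢0 (trans (sym (indexOf-here ρ (b ∷ []))) h))
... | no na | yes refl = ⊥-elim (1+n≢0 (trans
    (sym (trans (indexOf-there ρ a (ρ ∷ []) na) (cong (shift 1) (indexOf-here ρ [])))) h))
... | no na | no nb = na , nb

indexOf₂-present : ∀ ρ a b → indexOf ρ (a ∷ b ∷ []) ≢ 0 → ρ ≡ a ⊎ ρ ≡ b
indexOf₂-present ρ a b h with ρ ≟ᵖ a | ρ ≟ᵖ b
... | yes p | _ = inj₁ p
... | no _ | yes q = inj₂ q
... | no na | no nb = ⊥-elim (h (indexOf-absent ρ _ (na ∷ nb ∷ [])))

indexOf₂-absent-swap : ∀ ρ a b → indexOf ρ (a ∷ b ∷ []) ≡ 0 → indexOf ρ (b ∷ a ∷ []) ≡ 0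
indexOf₂-absent-swap ρ a b h = indexOf-absent ρ _
  (proj₂ (indexOf₂-absent ρ a b h) ∷ proj₁ (indexOf₂-absent ρ a b h) ∷ [])

middle-SwapEntry : ∀ i U (x y z : ℕ) → x < y → (swappedPair i U ≡ (z , y) ⊎ swappedPair i U ≡ (y , x)) →
  SwapEntry i U y
middle-SwapEntry i U x y z xy h with swappedPair-entries i U
... | inj₂ (c1 , c2) with h
...   | inj₁ e = subst (SwapEntry i U) (cong proj₂ e) c2
...   | inj₂ e = subst (SwapEntry i U) (cong proj₁ e) c1
middle-SwapEntry i U x y z xy h | inj₁ e0 with h
...   | inj₁ e = ⊥-elim (<⇒≢ (≤-trans (s≤s z≤n) xy) (sym (trans (sym (cong proj₂ e)) (cong proj₂ e0))))
...   | inj₂ e = ⊥-elim (<⇒≢ (≤-trans (s≤s z≤n) xy) (sym (trans (sym (cong proj₁ e)) (cong proj₁ e0))))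

Γ-Comm : ∀ n u v i j → Far i j → ∀ x y z → x < y → y < z →
  Γ n (u ++ i ∷ j ∷ v) (x , y , z) ≡ Γ n (u ++ j ∷ i ∷ v) (x , y , z)
Γ-Comm n u v i j far x y z xy yz = Γ-cong n (u ++ i ∷ j ∷ v) (u ++ j ∷ i ∷ v) x y z
  (subst₂ (λ S1 S2 → (indexOf (z , y) S1 <ᵇ indexOf (y , x) S1) ≡ (indexOf (z , y) S2 <ᵇ indexOf (y , x) S2))
     (sym eqa) (sym eqb) (BB.<ᵇ-preserved (z , y) (y , x) nins))
  where
  I0 = idWord n
  U = act I0 u
  dU : Distinct U
  dU = Distinct-act I0 u (Distinct-idWord n)
  e1 = swappedPair i U
  e2 = swappedPair j U
  M = swaps (swapAt j (swapAt i U)) v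
  L = swaps I0 u
  far2 : Far j i
  far2 = Far-sym far
  eqa : swaps I0 (u ++ i ∷ j ∷ v) ≡ L ++ ((e1 ∷ e2 ∷ []) ++ M)
  eqa = trans (swaps-++ I0 u (i ∷ j ∷ v)) (cong (λ q → L ++ (e1 ∷ q ∷ M)) (swappedPair-far j i U far2))
  eqb : swaps I0 (u ++ j ∷ i ∷ v) ≡ L ++ ((e2 ∷ e1 ∷ []) ++ M)
  eqb = trans (swaps-++ I0 u (j ∷ i ∷ v)) (cong₂ (λ q r → L ++ (e2 ∷ q ∷ r)) (swappedPair-far i j U far)
          (cong (λ W → swaps W v) (swapAt-comm-far i j U far)))
  module BB = BlockReorder L (e1 ∷ e2 ∷ []) (e2 ∷ e1 ∷ []) M refl (λ ρ → indexOf₂-absent-swap ρ e1 e2)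
    (λ ρ → indexOf₂-absent-swap ρ e2 e1)
  nins : ¬ (BB.FromBlock (z , y) × BB.FromBlock (y , x))
  nins ((_ , n1) , (_ , n2)) with indexOf₂-present _ e1 e2 n1 | indexOf₂-present _ e1 e2 n2
  ... | inj₁ a | inj₁ b = <⇒≢ yz (sym (cong proj₁ (trans a (sym b))))
  ... | inj₂ a | inj₂ b = <⇒≢ yz (sym (cong proj₁ (trans a (sym b))))
  ... | inj₁ a | inj₂ b = SwapEntry-far-disjoint i j U y dU far
      (middle-SwapEntry i U x y z xy (inj₁ (sym a))) (middle-SwapEntry j U x y z xy (inj₂ (sym b)))
  ... | inj₂ a | inj₁ b = SwapEntry-far-disjoint i j U y dU far
      (middle-SwapEntry i U x y z xy (inj₂ (sym b))) (middle-SwapEntry j U x y z xy (inj₁ (sym a)))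

TripleOf : List ℕ → ℕ → ℕ → ℕ → Set
TripleOf w x y z = x < y × y < z × pos z w < pos y w × pos y w < pos x w

isTriple⇒TripleOf : ∀ w x y z → isTriple w (x , y , z) ≡ true → TripleOf w x y z
isTriple⇒TripleOf w x y z h with x <ᵇ y in e1 | y <ᵇ z in e2 | pos z w <ᵇ pos y w in e3 | pos y w <ᵇ
  pos x w in e4
... | true | true | true | true = <ᵇ-true⇒< _ _ e1 , <ᵇ-true⇒< _ _ e2 , <ᵇ-true⇒< _ _ e3 , <ᵇ-true⇒< _ _ e4

TripleOf⇒isTriple : ∀ w x y z → TripleOf w x y z → isTriple w (x , y , z) ≡ true
TripleOf⇒isTriple w x y z (a , b , c , d) rewrite <⇒<ᵇ-true _ _ a | <⇒<ᵇ-true _ _ b | <⇒<ᵇ-true _ _ c |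
  <⇒<ᵇ-true _ _ d = refl

¬TripleOf⇒isTriple : ∀ w x y z → ¬ TripleOf w x y z → isTriple w (x , y , z) ≡ false
¬TripleOf⇒isTriple w x y z h with isTriple w (x , y , z) in e
... | true = ⊥-elim (h (isTriple⇒TripleOf w x y z e))
... | false = refl

filter-cong : ∀ {A : Set} (P f g : A → Bool) L → (∀ τ → P τ ≡ true → f τ ≡ g τ) →
  filterᵇ f (filterᵇ P L) ≡ filterᵇ g (filterᵇ P L)
filter-cong P f g [] h = refl
filter-cong P f g (τ ∷ L) h with P τ in e
... | false = filter-cong P f g L h
... | true rewrite h τ e with g τ
...   | true = cong (τ ∷_) (filter-cong P f g L h)
...   | false = filter-cong P f g L h

t-cong : ∀ n w a b → (∀ x y z → x < y → y < z → Γ n a (x , y , z) ≡ Γ n b (x , y , z)) → t n w a ≡ t n w b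
t-cong n w a b h = cong length (filter-cong (isTriple w) _ _ (allTriples n) pt)
  where
  pt : ∀ τ → isTriple w τ ≡ true → not (Γ n (amin w) τ ≡ᵇ Γ n a τ) ≡ not (Γ n (amin w) τ ≡ᵇ Γ n b τ)
  pt (x , y , z) e with isTriple⇒TripleOf w x y z e
  ... | (xy , yz , _) rewrite h x y z xy yz = refl

t-Comm : ∀ n w a b → Comm a b → t n w a ≡ t n w b
t-Comm n w _ _ (comm u v i j h) = t-cong n w (u ++ i ∷ j ∷ v) (u ++ j ∷ i ∷ v)
  (λ x y z xy yz → Γ-Comm n u v i j (gap⇒Far h) x y z xy yz)

Comm-sym : ∀ a b → Comm a b → Comm b a
Comm-sym _ _ (comm u v i j (inj₁ h)) = comm u v j i (inj₂ h)
Comm-sym _ _ (comm u v i j (inj₂ h)) = comm u v j i (inj₁ h)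

t-∼ : ∀ n w a b → a ∼ b → t n w a ≡ t n w b
t-∼ n w a .a ε = refl
t-∼ n w a b (c ◅ r) = trans (t-Comm n w _ _ c) (t-∼ n w _ b r)

∼-sym : ∀ a b → a ∼ b → b ∼ a
∼-sym a .a ε = ε
∼-sym a b (c ◅ r) = ∼-sym _ b r ◅◅ (Comm-sym _ _ c ◅ ε)

countLess-applyUpTo : ∀ (f : ℕ → ℕ) n b → (∀ i → b < f i) → countLess (suc b) (map suc (applyUpTo f n)) ≡ 0
countLess-applyUpTo f zero b h = refl
countLess-applyUpTo f (suc n) b h rewrite ≥⇒<ᵇ-false (suc (f 0)) (suc b) (s≤s (<⇒≤ (h 0))) =
  countLess-applyUpTo (λ z → f (suc z)) n b (λ i → h (suc i))

inv-applyUpTo : ∀ (f : ℕ → ℕ) n → (∀ i j → i < j → f i < f j) → inv (map suc (applyUpTo f n)) ≡ 0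
inv-applyUpTo f zero h = refl
inv-applyUpTo f (suc n) h rewrite countLess-applyUpTo (λ z → f (suc z)) n (f 0)
  (λ i → h 0 (suc i) (s≤s z≤n)) =
  inv-applyUpTo (λ z → f (suc z)) n (λ i j lt → h (suc i) (suc j) (s≤s lt))

inv-idWord : ∀ n → inv (idWord n) ≡ 0
inv-idWord n = inv-applyUpTo (λ z → z) n (λ i j lt → lt)

length-act-idWord : ∀ n a → length (act (idWord n) a) ≡ n
length-act-idWord n a = trans (length-act (idWord n) a) (length-idWord n)

Reduced→Red : ∀ n w a → Reduced n w a → RedFrom (idWord n) a
Reduced→Red n w a (_ , e , l) = inv-act⇒RedFrom (idWord n) a (Distinct-idWord n)
  (trans (cong inv e) (trans (sym l) (cong (_+ length a) (sym (inv-idWord n)))))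

RedFrom-letters : ∀ u a → RedFrom u a → All (λ i → 1 ≤ i × i < length u) a
RedFrom-letters u [] r = []
RedFrom-letters u (suc j ∷ a) ((v , _) , r) = (s≤s z≤n , v) ∷ All.map
  (λ {i} h → proj₁ h , subst (i <_) (length-swapAt (suc j) u) (proj₂ h))
    (RedFrom-letters (swapAt (suc j) u) a r)

Red→Reduced : ∀ n a → RedFrom (idWord n) a → Reduced n (act (idWord n) a) a
Red→Reduced n a r = All.map
  (λ {i} h → proj₁ h , subst (i <_) (length-idWord n) (proj₂ h)) (RedFrom-letters (idWord n) a r) ,
  refl , sym (trans (RedFrom⇒inv-act (idWord n) a r) (cong (_+ length a) (inv-idWord n)))

length-++-cong : ∀ (u : List ℕ) {x y : List ℕ} → length x ≡ length y → length (u ++ x) ≡ length (u ++ y)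
length-++-cong u {x} {y} e = trans (length-++ u) (trans (cong (length u +_) e) (sym (length-++ u)))

Reduced-Comm : ∀ n w a b → Comm a b → Reduced n w a → Reduced n w b
Reduced-Comm n w _ _ (comm u v i j h) (ls , e , l) =
  ++⁺ (proj₁ (++⁻ u ls)) (lj ∷ li ∷ lv) ,
  trans (act-++ (idWord n) u (j ∷ i ∷ v)) (trans (cong (λ W → act W v) (swapAt-comm-far i j _ (gap⇒Far h)))
    (trans (sym (act-++ (idWord n) u (i ∷ j ∷ v))) e)) ,
  trans (sym (length-++-cong u refl)) l
  where
  rest = proj₂ (++⁻ u ls)
  li = All.head rest
  lj = All.head (All.tail rest)
  lv = All.tail (All.tail rest)

Reduced-∼ : ∀ n w a b → a ∼ b → Reduced n w a → Reduced n w b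
Reduced-∼ n w a .a ε r = r
Reduced-∼ n w a b (c ◅ s) r = Reduced-∼ n w _ b s (Reduced-Comm n w _ _ c r)

Reduced-Braid : ∀ n w a b → Braid a b → Reduced n w a → Reduced n w b
Reduced-Braid n w _ _ (braidUp u v zero) (ls , e , l) = ⊥-elim
  (1+n≰n (proj₁ (All.head (proj₂ (++⁻ u ls)))))
Reduced-Braid n w _ _ (braidUp u v (suc k)) (ls , e , l) =
  ++⁺ (proj₁ (++⁻ u ls)) (l2 ∷ l1 ∷ l2 ∷ lv) ,
  trans (act-++ (idWord n) u (2 + k ∷ suc k ∷ 2 + k ∷ v))
    (trans (cong (λ W → act W v) (sym (swapAt-braid k _ bound)))
    (trans (sym (act-++ (idWord n) u (suc k ∷ 2 + k ∷ suc k ∷ v))) e)) ,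
  trans (sym (length-++-cong u refl)) l
  where
  rest = proj₂ (++⁻ u ls)
  l1 = All.head rest
  l2 = All.head (All.tail rest)
  lv = All.tail (All.tail
    (All.tail rest))
  bound : 3 + k ≤ length (act (idWord n) u)
  bound = subst (3 + k ≤_) (sym (length-act-idWord n u)) (proj₂ l2)
Reduced-Braid n w _ _ (braidDown u v zero) (ls , e , l) = ⊥-elim
  (1+n≰n (proj₁ (All.head (All.tail (proj₂ (++⁻ u ls))))))
Reduced-Braid n w _ _ (braidDown u v (suc k)) (ls , e , l) =
  ++⁺ (proj₁ (++⁻ u ls)) (l1 ∷ l2 ∷ l1 ∷ lv) ,
  trans (act-++ (idWord n) u (suc k ∷ 2 + k ∷ suc k ∷ v))
    (trans (cong (λ W → act W v) (swapAt-braid k _ bound))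
    (trans (sym (act-++ (idWord n) u (2 + k ∷ suc k ∷ 2 + k ∷ v))) e)) ,
  trans (sym (length-++-cong u refl)) l
  where
  rest = proj₂ (++⁻ u ls)
  l2 = All.head rest
  l1 = All.head (All.tail rest)
  lv = All.tail (All.tail
    (All.tail rest))
  bound : 3 + k ≤ length (act (idWord n) u)
  bound = subst (3 + k ≤_) (sym (length-act-idWord n u)) (proj₂ l2)

Braid-sym : ∀ a b → Braid a b → Braid b a
Braid-sym _ _ (braidUp u v i) = braidDown u v i
Braid-sym _ _ (braidDown u v i) = braidUp u v i

Comm-++ʳ : ∀ a b c → Comm a b → Comm (a ++ c) (b ++ c)
Comm-++ʳ _ _ c (comm u v i j h) = subst₂ Comm (sym (++-assoc u (i ∷ j ∷ v) c))
  (sym (++-assoc u (j ∷ i ∷ v) c)) (comm u (v ++ c) i j h)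

∼-++ʳ : ∀ a b c → a ∼ b → (a ++ c) ∼ (b ++ c)
∼-++ʳ a .a c ε = ε
∼-++ʳ a b c (x ◅ r) = Comm-++ʳ _ _ c x ◅ ∼-++ʳ _ b c r

Braid-++ʳ : ∀ a b c → Braid a b → Braid (a ++ c) (b ++ c)
Braid-++ʳ _ _ c (braidUp u v i) = subst₂ Braid (sym (++-assoc u (i ∷ suc i ∷ i ∷ v) c))
  (sym (++-assoc u (suc i ∷ i ∷ suc i ∷ v) c)) (braidUp u (v ++ c) i)
Braid-++ʳ _ _ c (braidDown u v i) = subst₂ Braid (sym (++-assoc u (suc i ∷ i ∷ suc i ∷ v) c))
  (sym (++-assoc u (i ∷ suc i ∷ i ∷ v) c)) (braidDown u (v ++ c) i)

-- The partial order on commutation classes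

Cover-t< : ∀ n w a b → Cover n w a b → t n w a < t n w b
Cover-t< n w a b (a2 , b2 , r1 , r2 , br , e) =
  subst₂ _<_ (sym (t-∼ n w a a2 r1)) (sym (t-∼ n w b b2 r2)) (subst (t n w a2 <_) (sym e) ≤-refl)

Cover-t : ∀ n w a b → Cover n w a b → t n w b ≡ suc (t n w a)
Cover-t n w a b (a2 , b2 , r1 , r2 , br , e) = trans (t-∼ n w b b2 r2)
  (trans e (cong suc (sym (t-∼ n w a a2 r1))))

Lt-t< : ∀ n w a b → Lt n w a b → t n w a < t n w b
Lt-t< n w a b [ c ] = Cover-t< n w a b c
Lt-t< n w a b (c ∷ r) = <-trans (Cover-t< n w a _ c) (Lt-t< n w _ b r)

Reduced-Cover : ∀ n w a b → Reduced n w a → Cover n w a b → Reduced n w b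
Reduced-Cover n w a b r (a2 , b2 , r1 , r2 , br , e) =
  Reduced-∼ n w b2 b (∼-sym b b2 r2) (Reduced-Braid n w a2 b2 br (Reduced-∼ n w a a2 r1 r))

∼-Cover : ∀ n w a b c → a ∼ b → Cover n w b c → Cover n w a c
∼-Cover n w a b c s (a2 , b2 , r1 , r2 , br , e) = a2 , b2 , s ◅◅ r1 , r2 , br , e

Cover-∼ : ∀ n w a b c → Cover n w a b → b ∼ c → Cover n w a c
Cover-∼ n w a b c (a2 , b2 , r1 , r2 , br , e) s = a2 , b2 , r1 , ∼-sym b c s ◅◅ r2 , br , e

∼-Lt : ∀ n w a b c → a ∼ b → Lt n w b c → Lt n w a c
∼-Lt n w a b c s [ x ] = [ ∼-Cover n w a b c s x ]
∼-Lt n w a b c s (x ∷ r) = ∼-Cover n w a b _ s x ∷ r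

Lt-∼ : ∀ n w a b c → Lt n w a b → b ∼ c → Lt n w a c
Lt-∼ n w a b c [ x ] s = [ Cover-∼ n w a b c x s ]
Lt-∼ n w a b c (x ∷ r) s = x ∷ Lt-∼ n w _ b c r s

Lt-trans : ∀ n w a b c → Lt n w a b → Lt n w b c → Lt n w a c
Lt-trans n w a b c [ x ] q = x ∷ q
Lt-trans n w a b c (x ∷ p) q = x ∷ Lt-trans n w _ b c p q

≤C-isPartialOrder : ∀ n w → IsPartialOrder (_≈C_ {n} {w}) (_≤C_ {n} {w})
≤C-isPartialOrder n w = record
  { isPreorder = record
    { isEquivalence = record { refl = λ {a} → ε ; sym = λ {a} {b} → ∼-sym (proj₁ a) (proj₁ b) ; trans = _◅◅_ }
    ; reflexive = λ {a} {b} e → inj₁ e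
    ; trans = λ {a} {b} {c} → tr {a} {b} {c}
    }
  ; antisym = λ {a} {b} → anti {a} {b}
  }
  where
  tr : ∀ {a b c : RW n w} → a ≤C b → b ≤C c → a ≤C c
  tr (inj₁ p) (inj₁ q) = inj₁ (p ◅◅ q)
  tr {a} {b} {c} (inj₁ p) (inj₂ q) = inj₂ (∼-Lt n w (proj₁ a) (proj₁ b) (proj₁ c) p q)
  tr {a} {b} {c} (inj₂ p) (inj₁ q) = inj₂ (Lt-∼ n w (proj₁ a) (proj₁ b) (proj₁ c) p q)
  tr {a} {b} {c} (inj₂ p) (inj₂ q) = inj₂ (Lt-trans n w (proj₁ a) (proj₁ b) (proj₁ c) p q)
  anti : ∀ {a b : RW n w} → a ≤C b → b ≤C a → a ≈C b
  anti (inj₁ p) _ = p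
  anti {a} {b} (inj₂ p) (inj₁ q) = ⊥-elim (<-irrefl (sym (t-∼ n w (proj₁ b) (proj₁ a) q)) (Lt-t< n w _ _ p))
  anti {a} {b} (inj₂ p) (inj₂ q) = ⊥-elim (<-asym (Lt-t< n w _ _ p) (Lt-t< n w _ _ q))

t-≈C : ∀ n w (a b : RW n w) → a ≈C b → t n w (proj₁ a) ≡ t n w (proj₁ b)
t-≈C n w a b e = t-∼ n w (proj₁ a) (proj₁ b) e

t-CoversC : ∀ n w (a b : RW n w) → CoversC a b → t n w (proj₁ b) ≡ suc (t n w (proj₁ a))
t-CoversC n w a b ([ c ] , _) = Cover-t n w _ _ c
t-CoversC n w a b (c ∷ r , h) = ⊥-elim (h ((_ , Reduced-Cover n w _ _ (proj₂ a) c) , [ c ] , r))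

InRange : ℕ → ℕ → Set
InRange n v = 1 ≤ v × v ≤ n

Occurs-idWord : ∀ n v → InRange n v → Occurs v (idWord n)
Occurs-idWord n v (a , b) = v , (a , subst (v ≤_) (sym (length-idWord n)) b) , get-idWord n v
  (a , subst (v ≤_) (sym (length-idWord n)) b)

indexOf-snoc-other : ∀ ρ e L → ρ ≢ e → indexOf ρ (L ++ e ∷ []) ≡ indexOf ρ L
indexOf-snoc-other ρ e L ne with indexOf ρ L ≟ 0
... | no nz = indexOf-++-present ρ L _ nz
... | yes z = trans (indexOf-++-absent ρ L _ z)
    (trans (cong (shift (length L)) (trans (indexOf-there ρ e [] ne) refl)) (sym z))

indexOf-snoc-new : ∀ e L → indexOf e L ≡ 0 → indexOf e (L ++ e ∷ []) ≡ suc (length L)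
indexOf-snoc-new e L z = trans (indexOf-++-absent e L _ z)
  (trans (cong (shift (length L)) (indexOf-here e [])) (+-comm (length L) 1))

indexOf-snoc-≤ : ∀ ρ L e → indexOf ρ (L ++ e ∷ []) ≤ suc (length L)
indexOf-snoc-≤ ρ L e = subst (indexOf ρ (L ++ e ∷ []) ≤_) (trans (length-++ L) (+-comm (length L) 1))
  (indexOf-≤-length ρ (L ++ e ∷ []))

-- Appending the ascent suc j of W1 to a reduced word X of W1 creates the single new inversion
-- e = (p , q), labelled last. Triples of W1 keep their Γ; the new triples of W are those in which e
-- is one of the two compared pairs, and their Γ is forced by e being last.

module AppendLetter (n : ℕ) (W1 : List ℕ) (j : ℕ) (dW1 : Distinct W1) (asc : Ascent (suc j) W1)
  (memW1 : ∀ v → InRange n v → Occurs v W1) where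

  I0 = idWord n
  W = swapAt (suc j) W1
  dW : Distinct W
  dW = Distinct-swapAt (suc j) W1 dW1
  vj : 2 + j ≤ length W1
  vj = proj₁ asc
  p = get (2 + j) W1
  q = get (suc j) W1
  qp : q < p
  qp = proj₂ asc
  e : Pair
  e = (p , q)
  e≡ : swappedPair (suc j) W1 ≡ e
  e≡ = proj₂ (proj₂ (swappedPair-ascent (suc j) W1 asc))
  posW : ∀ v → InRange n v → pos v W ≡ σ j (pos v W1)
  posW v h = pos-swapAt j v W1 dW1 (memW1 v h) vj
  posp : pos p W1 ≡ 2 + j
  posp = pos-get W1 dW1 (2 + j) (s≤s z≤n , vj)
  posq : pos q W1 ≡ suc j
  posq = pos-get W1 dW1 (suc j) (s≤s z≤n , ≤-trans (n≤1+n _) vj)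
  getpos : ∀ v → InRange n v → get (pos v W1) W1 ≡ v
  getpos v h = proj₁ (get-pos v W1 (memW1 v h))

  e-notinv : ¬ Inversion p q W1
  e-notinv (_ , _ , _ , lt) = <-asym lt (subst₂ _<_ (sym posq) (sym posp) (n<1+n _))

  invne : ∀ a b → InRange n a → InRange n b → pos a W1 < pos b W1 → (a , b) ≢ e
  invne a b ha hb lt refl = <-asym lt (subst₂ _<_ (sym posq) (sym posp) (n<1+n _))

  vjW : 2 + j ≤ length W
  vjW = subst (2 + j ≤_) (sym (length-swapAt (suc j) W1)) vj
  memW : ∀ v → InRange n v → Occurs v W
  memW v h = Occurs-swapAt (suc j) v W1 (memW1 v h)
  posW1 : ∀ v → InRange n v → pos v W1 ≡ σ j (pos v W)
  posW1 v h = trans (cong (pos v) (sym (swapAt-involutive (suc j) W1))) (pos-swapAt j v W dW (memW v h) vjW)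
  getposW : ∀ v → InRange n v → get (pos v W) W ≡ v
  getposW v h = proj₁ (get-pos v W (memW v h))
  gW1 : get (suc j) W ≡ p
  gW1 = get-swapAt-fst j W1 vj
  gW2 : get (2 + j) W ≡ q
  gW2 = get-swapAt-snd j W1 vj

  module Before (X : List ℕ) (r : RedFrom (idWord n) X) (eX : act (idWord n) X ≡ W1) where
   L = swaps I0 X
   sw≡ : swaps I0 (X ++ suc j ∷ []) ≡ L ++ e ∷ []
   sw≡ = trans (swaps-++ I0 X (suc j ∷ []))
     (cong (λ z → L ++ z ∷ []) (trans (cong (swappedPair (suc j)) eX) e≡))
   e∉L : All (λ ρ → e ≢ ρ) L
   e∉L = All.map (λ {ρ} iv eq → e-notinv
     (subst (λ z → Inversion (proj₁ z) (proj₂ z) W1) (sym eq) (subst (Inversion (proj₁ ρ) (proj₂ ρ)) eX iv)))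
          (swaps-Inversion I0 X (Distinct-idWord n) r)
   idx-e : indexOf e L ≡ 0
   idx-e = indexOf-absent e L e∉L

   old-triple : ∀ a1 a2 a3 → InRange n a1 → InRange n a2 → InRange n a3 → TripleOf W1 a1 a2 a3 →
     TripleOf W a1 a2 a3 × Γ n (X ++ suc j ∷ []) (a1 , a2 , a3) ≡ Γ n X (a1 , a2 , a3)
   old-triple a1 a2 a3 h1 h2 h3 (l12 , l23 , pa , pb) =
     (l12 , l23 , subst₂ _<_ (sym (posW a3 h3)) (sym (posW a2 h2)) (σ-monotone j _ _ pa ex1) ,
                  subst₂ _<_ (sym (posW a2 h2)) (sym (posW a1 h1)) (σ-monotone j _ _ pb ex2)) ,
     Γ-cong n (X ++ suc j ∷ []) X a1 a2 a3
       (subst (λ S → (indexOf (a3 , a2) S <ᵇ indexOf (a2 , a1) S) ≡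
         (indexOf (a3 , a2) L <ᵇ indexOf (a2 , a1) L)) (sym sw≡)
         (cong₂ _<ᵇ_ (indexOf-snoc-other _ e L (invne a3 a2 h3 h2 pa))
           (indexOf-snoc-other _ e L (invne a2 a1 h2 h1 pb))))
     where
     ex1 : pos a3 W1 ≡ suc j → pos a2 W1 ≡ 2 + j → ⊥
     ex1 x y = <-asym l23 (subst₂ _<_ (trans (cong (λ z → get z W1) (sym x)) (getpos a3 h3))
       (trans (cong (λ z → get z W1) (sym y)) (getpos a2 h2)) qp)
     ex2 : pos a2 W1 ≡ suc j → pos a1 W1 ≡ 2 + j → ⊥
     ex2 x y = <-asym l12 (subst₂ _<_ (trans (cong (λ z → get z W1) (sym x)) (getpos a2 h2))
       (trans (cong (λ z → get z W1) (sym y)) (getpos a1 h1)) qp)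

   Γ-snoc : ∀ a1 a2 a3 → Γ n (X ++ suc j ∷ []) (a1 , a2 , a3) ≡
     (if indexOf (a3 , a2) (L ++ e ∷ []) <ᵇ indexOf (a2 , a1) (L ++ e ∷ []) then 1 else 0)
   Γ-snoc a1 a2 a3 = cong (λ S → if indexOf (a3 , a2) S <ᵇ indexOf (a2 , a1) S then 1 else 0) sw≡

   new-triple : ∀ a1 a2 a3 → InRange n a1 → InRange n a2 → InRange n a3 → TripleOf W a1 a2 a3 →
     ¬ TripleOf W1 a1 a2 a3 →
     ((a3 , a2) ≡ e × Γ n (X ++ suc j ∷ []) (a1 , a2 , a3) ≡ 0) ⊎
       ((a2 , a1) ≡ e × Γ n (X ++ suc j ∷ []) (a1 , a2 , a3) ≡ 1)
   new-triple a1 a2 a3 h1 h2 h3 (l12 , l23 , pa , pb) nt with (pos a3 W ≟ suc j) ×-dec (pos a2 W ≟ 2 + j)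
   ... | yes (x , y) = inj₁ (e1 , trans (Γ-snoc a1 a2 a3) (cong (λ b → if b then 1 else 0)
            (trans (cong (_<ᵇ indexOf (a2 , a1) (L ++ e ∷ []))
              (trans (cong (λ z → indexOf z (L ++ e ∷ [])) e1) (indexOf-snoc-new e L idx-e)))
                   (≥⇒<ᵇ-false _ _ (indexOf-snoc-≤ (a2 , a1) L e)))))
     where
     e1 : (a3 , a2) ≡ e
     e1 = cong₂ _,_ (trans (sym (getposW a3 h3)) (trans (cong (λ z → get z W) x) gW1))
                    (trans (sym (getposW a2 h2)) (trans (cong (λ z → get z W) y) gW2))
   ... | no n1 with (pos a2 W ≟ suc j) ×-dec (pos a1 W ≟ 2 + j)
   ...   | yes (x , y) = inj₂ (e2 , trans (Γ-snoc a1 a2 a3) (cong (λ b → if b then 1 else 0)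
            (trans (cong₂ _<ᵇ_ (indexOf-snoc-other (a3 , a2) e L ne1)
              (trans (cong (λ z → indexOf z (L ++ e ∷ [])) e2) (indexOf-snoc-new e L idx-e)))
                   (<⇒<ᵇ-true _ _ (s≤s (indexOf-≤-length (a3 , a2) L))))))
     where
     e2 : (a2 , a1) ≡ e
     e2 = cong₂ _,_ (trans (sym (getposW a2 h2)) (trans (cong (λ z → get z W) x) gW1))
                    (trans (sym (getposW a1 h1)) (trans (cong (λ z → get z W) y) gW2))
     ne1 : (a3 , a2) ≢ e
     ne1 eq = <-irrefl (trans (sym (cong proj₂ eq)) (cong proj₁ e2)) qp
   ...   | no n2 = ⊥-elim (nt (l12 , l23 ,
            subst₂ _<_ (sym (posW1 a3 h3)) (sym (posW1 a2 h2)) (σ-monotone j _ _ pa (λ x y → n1 (x , y))) ,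
            subst₂ _<_ (sym (posW1 a2 h2)) (sym (posW1 a1 h1)) (σ-monotone j _ _ pb (λ x y → n2 (x , y)))))

count : ∀ {A : Set} → (A → Bool) → List A → ℕ
count f L = length (filterᵇ f L)

count-∷ : ∀ {A : Set} (f : A → Bool) x L → count f (x ∷ L) ≡ bit (f x) + count f L
count-∷ f x L with f x
... | true = refl
... | false = refl

count-pointwise : ∀ {A : Set} (Q : A → Set) (f1 f2 g1 g2 : A → Bool) L → All Q L →
  (∀ τ → Q τ → bit (f1 τ) + bit (f2 τ) ≡ bit (g1 τ) + bit (g2 τ)) →
  count f1 L + count f2 L ≡ count g1 L + count g2 L
count-pointwise Q f1 f2 g1 g2 [] [] h = refl
count-pointwise Q f1 f2 g1 g2 (x ∷ L) (q ∷ qs) h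
  rewrite count-∷ f1 x L | count-∷ f2 x L | count-∷ g1 x L | count-∷ g2 x L =
  begin
    (bit (f1 x) + count f1 L) + (bit (f2 x) + count f2 L) ≡⟨ interchange (bit (f1 x)) _ _ _ ⟩
    (bit (f1 x) + bit (f2 x)) + (count f1 L + count f2 L) ≡⟨ cong₂ _+_ (h x q)
      (count-pointwise Q f1 f2 g1 g2 L qs h) ⟩
    (bit (g1 x) + bit (g2 x)) + (count g1 L + count g2 L) ≡⟨ interchange (bit (g1 x)) _ _ _ ⟩
    (bit (g1 x) + count g1 L) + (bit (g2 x) + count g2 L) ∎
  where open ≡-Reasoning

InRange³ : ℕ → ℕ × ℕ × ℕ → Set
InRange³ n (a , b , c) = InRange n a × InRange n b × InRange n c

All-InRange-idWord : ∀ n → All (InRange n) (idWord n)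
All-InRange-idWord n = Allₚ.map⁺ (Allₚ.applyUpTo⁺₁ (λ z → z) n (λ i<n → s≤s z≤n , i<n))

All-InRange³-allTriples : ∀ n → All (InRange³ n) (allTriples n)
All-InRange³-allTriples n =
  Allₚ.concat⁺ (Allₚ.map⁺ (All.map (λ hx →
    Allₚ.concat⁺ (Allₚ.map⁺ (All.map (λ hy →
      Allₚ.map⁺ (All.map (λ hz → hx , hy , hz) ids)) ids))) ids))
  where
  ids = All-InRange-idWord n

mismatches : ℕ → List ℕ → List ℕ → ℕ → ℕ
mismatches n w a g = count (λ τ → isTriple w τ ∧ not (Γ n a τ ≡ᵇ g)) (allTriples n)

TripleOf? : ∀ w a1 a2 a3 → Dec (TripleOf w a1 a2 a3)
TripleOf? w a1 a2 a3 with isTriple w (a1 , a2 , a3) in e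
... | true = yes (isTriple⇒TripleOf w a1 a2 a3 e)
... | false = no (λ t → true≢false (trans (sym (TripleOf⇒isTriple w a1 a2 a3 t)) e))

module AppendLetterCount (n : ℕ) (W1 : List ℕ) (j : ℕ) (dW1 : Distinct W1) (asc : Ascent (suc j) W1)
  (memW1 : ∀ v → InRange n v → Occurs v W1) (X Y : List ℕ) (rX : RedFrom (idWord n) X)
    (eX : act (idWord n) X ≡ W1) (rY : RedFrom (idWord n) Y)
            (eY : act (idWord n) Y ≡ W1) where
  open AppendLetter n W1 j dW1 asc memW1
  module MX = Before X rX eX
  module MY = Before Y rY eY

  mismatches-snoc : ∀ g →
    mismatches n W (X ++ suc j ∷ []) g + mismatches n W1 Y g ≡ mismatches n W (Y ++ suc j ∷ []) g +
      mismatches n W1 X g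
  mismatches-snoc g = count-pointwise (InRange³ n) (F W (X ++ suc j ∷ [])) (F W1 Y) (F W (Y ++ suc j ∷ []))
    (F W1 X) (allTriples n) (All-InRange³-allTriples n) pt
    where
    F : List ℕ → List ℕ → ℕ × ℕ × ℕ → Bool
    F w a τ = isTriple w τ ∧ not (Γ n a τ ≡ᵇ g)
    pt : ∀ τ → InRange³ n τ →
      bit (F W (X ++ suc j ∷ []) τ) + bit (F W1 Y τ) ≡ bit (F W (Y ++ suc j ∷ []) τ) + bit (F W1 X τ)
    pt (a1 , a2 , a3) (h1 , h2 , h3) with TripleOf? W1 a1 a2 a3
    ... | yes t1 rewrite TripleOf⇒isTriple W a1 a2 a3 (proj₁ (MX.old-triple a1 a2 a3 h1 h2 h3 t1)) |
        TripleOf⇒isTriple W1 a1 a2 a3 t1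
                 | proj₂ (MX.old-triple a1 a2 a3 h1 h2 h3 t1) | proj₂ (MY.old-triple a1 a2 a3 h1 h2 h3 t1) =
                 +-comm (bit (not (Γ n X (a1 , a2 , a3) ≡ᵇ g))) _
    ... | no t1 with TripleOf? W a1 a2 a3
    ...   | no t2 rewrite ¬TripleOf⇒isTriple W a1 a2 a3 t2 | ¬TripleOf⇒isTriple W1 a1 a2 a3 t1 = refl
    ...   | yes t2 rewrite TripleOf⇒isTriple W a1 a2 a3 t2 | ¬TripleOf⇒isTriple W1 a1 a2 a3 t1 = cong
        (λ v → bit (not (v ≡ᵇ g)) + 0) geq
      where
      geq : Γ n (X ++ suc j ∷ []) (a1 , a2 , a3) ≡ Γ n (Y ++ suc j ∷ []) (a1 , a2 , a3)
      geq with MX.new-triple a1 a2 a3 h1 h2 h3 t2 t1 | MY.new-triple a1 a2 a3 h1 h2 h3 t2 t1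
      ... | inj₁ (_ , u) | inj₁ (_ , v) = trans u (sym v)
      ... | inj₂ (_ , u) | inj₂ (_ , v) = trans u (sym v)
      ... | inj₁ (e1 , _) | inj₂ (e2 , _) = ⊥-elim (<-irrefl (trans (sym (cong proj₂ e1)) (cong proj₁ e2)) qp)
      ... | inj₂ (e2 , _) | inj₁ (e1 , _) = ⊥-elim (<-irrefl (trans (sym (cong proj₂ e1)) (cong proj₁ e2)) qp)

count-++ : ∀ {A : Set} (f : A → Bool) L R → count f (L ++ R) ≡ count f L + count f R
count-++ f [] R = refl
count-++ f (x ∷ L) R rewrite count-∷ f x (L ++ R) | count-∷ f x L | count-++ f L R = sym
  (+-assoc (bit (f x)) _ _)

count-map : ∀ {A B : Set} (f : B → Bool) (g : A → B) L → count f (map g L) ≡ count (λ x → f (g x)) L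
count-map f g [] = refl
count-map f g (x ∷ L) rewrite count-∷ f (g x) (map g L) | count-∷ (λ x → f (g x)) x L | count-map f g L = refl

count-cong : ∀ {A : Set} (f g : A → Bool) L → (∀ x → f x ≡ g x) → count f L ≡ count g L
count-cong f g [] h = refl
count-cong f g (x ∷ L) h rewrite count-∷ f x L | count-∷ g x L | h x | count-cong f g L h = refl

count-none : ∀ {A : Set} (f : A → Bool) L → (∀ x → f x ≡ false) → count f L ≡ 0
count-none f [] h = refl
count-none f (x ∷ L) h rewrite count-∷ f x L | h x = count-none f L h

count-split : ∀ {A : Set} (f g h : A → Bool) L → (∀ x → bit (f x) ≡ bit (g x) + bit (h x)) →
  count f L ≡ count g L + count h L
count-split f g h [] pt = refl
count-split f g h (x ∷ L) pt
  rewrite count-∷ f x L | count-∷ g x L | count-∷ h x L | pt x | count-split f g h L pt =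
  interchange (bit (g x)) _ _ _

count-concatMap-none : ∀ {A B : Set} (f : B → Bool) (h : A → List B) L → (∀ x → count f (h x) ≡ 0) →
  count f (concatMap h L) ≡ 0
count-concatMap-none f h [] z = refl
count-concatMap-none f h (x ∷ L) z =
  trans (count-++ f (h x) (concatMap h L)) (cong₂ _+_ (z x) (count-concatMap-none f h L z))

count-concatMap-single : ∀ {B : Set} (f : B → Bool) (h : ℕ → List B) α L → (∀ x → x ≢ α → count f (h x) ≡ 0) →
  count f (concatMap h L) ≡ count (λ x → x ≡ᵇ α) L * count f (h α)
count-concatMap-single f h α [] hz = refl
count-concatMap-single f h α (x ∷ L) hz rewrite count-++ f (h x) (concatMap h L) | count-concatMap-single
  f h α L hz
  | count-∷ (λ x → x ≡ᵇ α) x L with x ≟ α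
... | yes refl rewrite ≡ᵇ-refl x = refl
... | no ne rewrite ≢⇒≡ᵇ-false x α ne | hz x ne = refl

count-≡ᵇ-absent : ∀ (f : ℕ → ℕ) m v → (∀ i → i < m → suc (f i) ≢ v) →
  count (λ x → x ≡ᵇ v) (map suc (applyUpTo f m)) ≡ 0
count-≡ᵇ-absent f zero v h = refl
count-≡ᵇ-absent f (suc m) v h rewrite count-∷ (λ x → x ≡ᵇ v) (suc (f 0))
  (map suc (applyUpTo (λ z → f (suc z)) m))
  | ≢⇒≡ᵇ-false (suc (f 0)) v (h 0 (s≤s z≤n)) = count-≡ᵇ-absent (λ z → f (suc z)) m v
    (λ i lt → h (suc i) (s≤s lt))

count-≡ᵇ-once : ∀ (f : ℕ → ℕ) m v → (∀ i j → i < j → f i < f j) → (Σ ℕ λ i → i < m × suc (f i) ≡ v) →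
  count (λ x → x ≡ᵇ v) (map suc (applyUpTo f m)) ≡ 1
count-≡ᵇ-once f zero v f-mono (i , () , _)
count-≡ᵇ-once f (suc m) .(suc (f 0)) f-mono (zero , lt , refl) rewrite count-∷ (λ x → x ≡ᵇ suc (f 0))
  (suc (f 0)) (map suc (applyUpTo (λ z → f (suc z)) m))
  | ≡ᵇ-refl (f 0) = cong suc (count-≡ᵇ-absent (λ z → f (suc z)) m (suc (f 0))
    (λ i lt2 e2 → <-irrefl (sym e2) (s≤s (f-mono 0 (suc i) (s≤s z≤n)))))
count-≡ᵇ-once f (suc m) v f-mono (suc i , s≤s lt , e) rewrite count-∷ (λ x → x ≡ᵇ v) (suc (f 0))
  (map suc (applyUpTo (λ z → f (suc z)) m))
  | ≢⇒≡ᵇ-false (suc (f 0)) v (λ e2 → <-irrefl (trans e2 (sym e)) (s≤s (f-mono 0 (suc i) (s≤s z≤n)))) =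
  count-≡ᵇ-once (λ z → f (suc z)) m v (λ a b l → f-mono (suc a) (suc b) (s≤s l)) (i , lt , e)

count-idWord : ∀ n v → InRange n v → count (λ x → x ≡ᵇ v) (idWord n) ≡ 1
count-idWord n (suc v) (_ , h) = count-≡ᵇ-once (λ z → z) n (suc v) (λ i j l → l) (v , h , refl)

≡ᵇ-triple : ℕ → ℕ → ℕ → ℕ × ℕ × ℕ → Bool
≡ᵇ-triple α β γ (a1 , a2 , a3) = (a1 ≡ᵇ α) ∧ ((a2 ≡ᵇ β) ∧ (a3 ≡ᵇ γ))

count-≡ᵇ-triple : ∀ n α β γ → InRange n α → InRange n β → InRange n γ →
  count (≡ᵇ-triple α β γ) (allTriples n) ≡ 1
count-≡ᵇ-triple n α β γ hα hβ hγ =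
  trans (count-concatMap-single (≡ᵇ-triple α β γ) H α I hz1)
    (trans (cong (_* count (≡ᵇ-triple α β γ) (H α)) (count-idWord n α hα))
   (trans (+-identityʳ _) (trans (count-concatMap-single (≡ᵇ-triple α β γ) (H2 α) β I hz2)
    (trans (cong (_* count (≡ᵇ-triple α β γ) (H2 α β)) (count-idWord n β hβ)) (trans (+-identityʳ _)
      (trans (count-map (≡ᵇ-triple α β γ) (λ z → (α , β , z)) I)
        (trans (count-cong _ (λ x → x ≡ᵇ γ) I (λ z → ee z)) (count-idWord n γ hγ))))))))
  where
  I = idWord n
  H2 : ℕ → ℕ → List (ℕ × ℕ × ℕ)
  H2 x y = map (λ z → (x , y , z)) I
  H : ℕ → List (ℕ × ℕ × ℕ)
  H x = concatMap (λ y → H2 x y) I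
  ee : ∀ z → ≡ᵇ-triple α β γ (α , β , z) ≡ (z ≡ᵇ γ)
  ee z rewrite ≡ᵇ-refl α | ≡ᵇ-refl β = refl
  hz2 : ∀ y → y ≢ β → count (≡ᵇ-triple α β γ) (H2 α y) ≡ 0
  hz2 y ne = trans (count-map _ _ I) (count-none _ I f)
    where
    f : ∀ z → ≡ᵇ-triple α β γ (α , y , z) ≡ false
    f z rewrite ≡ᵇ-refl α | ≢⇒≡ᵇ-false y β ne = refl
  hz1 : ∀ x → x ≢ α → count (≡ᵇ-triple α β γ) (H x) ≡ 0
  hz1 x ne = count-concatMap-none _ (H2 x) I (λ y → trans (count-map _ _ I) (count-none _ I (f y)))
    where
    f : ∀ y z → ≡ᵇ-triple α β γ (x , y , z) ≡ false
    f y z rewrite ≢⇒≡ᵇ-false x α ne = refl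

-- Long braid moves

indexOf-absent⁻ : ∀ ρ L → indexOf ρ L ≡ 0 → All (λ e → ρ ≢ e) L
indexOf-absent⁻ ρ [] h = []
indexOf-absent⁻ ρ (e ∷ L) h with ρ ≟ᵖ e
... | yes refl = ⊥-elim (1+n≢0 (trans (sym (indexOf-here ρ L)) h))
... | no ne = ne ∷ indexOf-absent⁻ ρ L (shift-1≡0 _ (trans (sym (indexOf-there ρ e L ne)) h))

indexOf₃-present : ∀ ρ a b c → indexOf ρ (a ∷ b ∷ c ∷ []) ≢ 0 → ρ ≡ a ⊎ ρ ≡ b ⊎ ρ ≡ c
indexOf₃-present ρ a b c h with ρ ≟ᵖ a | ρ ≟ᵖ b | ρ ≟ᵖ c
... | yes p | _ | _ = inj₁ p
... | no _ | yes q | _ = inj₂ (inj₁ q)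
... | no _ | no _ | yes r = inj₂ (inj₂ r)
... | no na | no nb | no nc = ⊥-elim (h (indexOf-absent ρ _ (na ∷ nb ∷ nc ∷ [])))

indexOf₃-absent-reverse : ∀ ρ a b c → indexOf ρ (a ∷ b ∷ c ∷ []) ≡ 0 → indexOf ρ (c ∷ b ∷ a ∷ []) ≡ 0
indexOf₃-absent-reverse ρ a b c h with indexOf-absent⁻ ρ (a ∷ b ∷ c ∷ []) h
... | na ∷ nb ∷ nc ∷ [] = indexOf-absent ρ _ (nc ∷ nb ∷ na ∷ [])

Occurs-idWord⁻ : ∀ n v → Occurs v (idWord n) → InRange n v
Occurs-idWord⁻ n v (k , ik , g) = subst (InRange n) (trans (sym (get-idWord n k ik)) g)
  (proj₁ ik , subst (k ≤_) (length-idWord n) (proj₂ ik))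

-- With α < β < γ the entries at positions j+1, j+2, j+3 before the braid factor, the factor
-- labels (β,α), (γ,α), (γ,β) in one order and the other factor in the reverse order; every other
-- comparison of labels is unchanged, so Γ flips at (α,β,γ) only.

module BraidFlip (n : ℕ) (Y V : List ℕ) (j : ℕ)
          (ra : RedFrom (idWord n) (Y ++ suc j ∷ 2 + j ∷ suc j ∷ V))
          (rb : RedFrom (idWord n) (Y ++ 2 + j ∷ suc j ∷ 2 + j ∷ V)) where
  I0 = idWord n
  Wa = Y ++ suc j ∷ 2 + j ∷ suc j ∷ V
  Wb = Y ++ 2 + j ∷ suc j ∷ 2 + j ∷ V
  U = act I0 Y
  dU : Distinct U
  dU = Distinct-act I0 Y (Distinct-idWord n)
  rY : RedFrom I0 Y
  rY = proj₁ (RedFrom-++⁻ I0 Y _ ra)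
  ra2 = proj₂ (RedFrom-++⁻ I0 Y _ ra)
  rb2 = proj₂ (RedFrom-++⁻ I0 Y _ rb)
  a1 = proj₁ ra2
  U1 = swapAt (suc j) U
  a2 = proj₁ (proj₂ ra2)
  U2 = swapAt (2 + j) U1
  a3 = proj₁ (proj₂ (proj₂ ra2))
  v1 : 2 + j ≤ length U
  v1 = proj₁ a1
  v3 : 3 + j ≤ length U
  v3 = subst (3 + j ≤_) (length-swapAt (suc j) U) (proj₁ a2)
  α = get (suc j) U
  β = get (2 + j) U
  γ = get (3 + j) U
  g1a : get (2 + j) U1 ≡ α
  g1a = get-swapAt-snd j U v1
  g1b : get (3 + j) U1 ≡ γ
  g1b = get-swapAt-other j (3 + j) U (λ e → n≢2+n (sym e)) (λ e → n≢1+n (sym e))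
  g1c : get (suc j) U1 ≡ β
  g1c = get-swapAt-fst j U v1
  g2a : get (suc j) U2 ≡ β
  g2a = trans (get-swapAt-other (suc j) (suc j) U1 n≢1+n n≢2+n) g1c
  g2b : get (2 + j) U2 ≡ γ
  g2b = trans (get-swapAt-fst (suc j) U1 (proj₁ a2)) g1b
  αβ : α < β
  αβ = proj₂ a1
  αγ : α < γ
  αγ = subst₂ _<_ g1a g1b (proj₂ a2)
  βγ : β < γ
  βγ = subst₂ _<_ g2a g2b (proj₂ a3)
  P1 P2 P3 : Pair
  P1 = (β , α)
  P2 = (γ , α)
  P3 = (γ , β)
  e1 : swappedPair (suc j) U ≡ P1
  e1 = proj₂ (proj₂ (swappedPair-ascent (suc j) U a1))
  e2 : swappedPair (2 + j) U1 ≡ P2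
  e2 = trans (proj₂ (proj₂ (swappedPair-ascent (2 + j) U1 a2))) (cong₂ _,_ g1b g1a)
  e3 : swappedPair (suc j) U2 ≡ P3
  e3 = trans (proj₂ (proj₂ (swappedPair-ascent (suc j) U2 a3))) (cong₂ _,_ g2b g2a)
  U3 = swapAt (suc j) U2
  L = swaps I0 Y
  M = swaps U3 V
  Sa : swaps I0 Wa ≡ L ++ ((P1 ∷ P2 ∷ P3 ∷ []) ++ M)
  Sa = trans (swaps-++ I0 Y _) (cong (L ++_) (cong₃ e1 e2 e3))
    where
    cong₃ : ∀ {x1 x2 x3 y1 y2 y3 : Pair} → x1 ≡ y1 → x2 ≡ y2 → x3 ≡ y3 → x1 ∷ x2 ∷ x3 ∷ M ≡ y1 ∷ y2 ∷ y3 ∷ M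
    cong₃ refl refl refl = refl
  b1 = proj₁ rb2
  V1 = swapAt (2 + j) U
  b2 = proj₁ (proj₂ rb2)
  V2 = swapAt (suc j) V1
  b3 = proj₁ (proj₂ (proj₂ rb2))
  v1b : 2 + j ≤ length V1
  v1b = subst (2 + j ≤_) (sym (length-swapAt (2 + j) U)) v1
  h1a : get (2 + j) V1 ≡ γ
  h1a = get-swapAt-fst (suc j) U v3
  h1b : get (suc j) V1 ≡ α
  h1b = get-swapAt-other (suc j) (suc j) U n≢1+n n≢2+n
  h2a : get (3 + j) V2 ≡ β
  h2a = trans (get-swapAt-other j (3 + j) V1 (λ e → n≢2+n (sym e)) (λ e → n≢1+n (sym e)))
    (get-swapAt-snd (suc j) U v3)
  h2b : get (2 + j) V2 ≡ α
  h2b = trans (get-swapAt-snd j V1 v1b) h1b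
  f1 : swappedPair (2 + j) U ≡ P3
  f1 = proj₂ (proj₂ (swappedPair-ascent (2 + j) U b1))
  f2 : swappedPair (suc j) V1 ≡ P2
  f2 = trans (proj₂ (proj₂ (swappedPair-ascent (suc j) V1 b2))) (cong₂ _,_ h1a h1b)
  f3 : swappedPair (2 + j) V2 ≡ P1
  f3 = trans (proj₂ (proj₂ (swappedPair-ascent (2 + j) V2 b3))) (cong₂ _,_ h2a h2b)
  Sb : swaps I0 Wb ≡ L ++ ((P3 ∷ P2 ∷ P1 ∷ []) ++ M)
  Sb = trans (swaps-++ I0 Y _) (cong (L ++_)
    (cong₄ f1 f2 f3 (cong (λ W → swaps W V) (sym (swapAt-braid j U v3)))))
    where
    cong₄ : ∀ {x1 x2 x3 y1 y2 y3 : Pair} {A B : List Pair} → x1 ≡ y1 → x2 ≡ y2 → x3 ≡ y3 → A ≡ B →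
      x1 ∷ x2 ∷ x3 ∷ A ≡ y1 ∷ y2 ∷ y3 ∷ B
    cong₄ refl refl refl refl = refl

  module BB = BlockReorder L (P1 ∷ P2 ∷ P3 ∷ []) (P3 ∷ P2 ∷ P1 ∷ []) M refl
    (λ ρ → indexOf₃-absent-reverse ρ P1 P2 P3) (λ ρ → indexOf₃-absent-reverse ρ P3 P2 P1)

  inB : Pair → Set
  inB ρ = ρ ≡ P1 ⊎ ρ ≡ P2 ⊎ ρ ≡ P3
  both : ∀ x y z → inB (z , y) → inB (y , x) → x ≡ α × y ≡ β × z ≡ γ
  both x y z (inj₁ refl) (inj₁ q) = ⊥-elim (<-irrefl (cong proj₁ q) αβ)
  both x y z (inj₁ refl) (inj₂ (inj₁ q)) = ⊥-elim (<-irrefl (cong proj₁ q) αγ)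
  both x y z (inj₁ refl) (inj₂ (inj₂ q)) = ⊥-elim (<-irrefl (cong proj₁ q) αγ)
  both x y z (inj₂ (inj₁ refl)) (inj₁ q) = ⊥-elim (<-irrefl (cong proj₁ q) αβ)
  both x y z (inj₂ (inj₁ refl)) (inj₂ (inj₁ q)) = ⊥-elim (<-irrefl (cong proj₁ q) αγ)
  both x y z (inj₂ (inj₁ refl)) (inj₂ (inj₂ q)) = ⊥-elim (<-irrefl (cong proj₁ q) αγ)
  both x y z (inj₂ (inj₂ refl)) (inj₁ q) = cong proj₂ q , refl , refl
  both x y z (inj₂ (inj₂ refl)) (inj₂ (inj₁ q)) = ⊥-elim (<-irrefl (cong proj₁ q) βγ)
  both x y z (inj₂ (inj₂ refl)) (inj₂ (inj₂ q)) = ⊥-elim (<-irrefl (cong proj₁ q) βγ)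

  Γ-other : ∀ x y z → ¬ (x ≡ α × y ≡ β × z ≡ γ) → Γ n Wa (x , y , z) ≡ Γ n Wb (x , y , z)
  Γ-other x y z nt = Γ-cong n Wa Wb x y z
    (subst₂ (λ S1 S2 → (indexOf (z , y) S1 <ᵇ indexOf (y , x) S1) ≡
      (indexOf (z , y) S2 <ᵇ indexOf (y , x) S2))
      (sym Sa) (sym Sb) (BB.<ᵇ-preserved (z , y) (y , x)
        (λ { ((_ , n1) , (_ , n2)) → nt (both x y z (indexOf₃-present _ P1 P2 P3 n1)
          (indexOf₃-present _ P1 P2 P3 n2)) })))

  invL : All (λ ρ → Inversion (proj₁ ρ) (proj₂ ρ) U) L
  invL = swaps-Inversion I0 Y (Distinct-idWord n) rY
  posα : pos α U ≡ suc j
  posα = pos-get U dU (suc j) (s≤s z≤n , ≤-trans (n≤1+n _) v1)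
  posβ : pos β U ≡ 2 + j
  posβ = pos-get U dU (2 + j) (s≤s z≤n , v1)
  posγ : pos γ U ≡ 3 + j
  posγ = pos-get U dU (3 + j) (s≤s z≤n , v3)
  P1∉ : indexOf P1 L ≡ 0
  P1∉ = indexOf-absent P1 L (All.map
    (λ {ρ} iv eq → <-asym (subst₂ _<_ (sym posα) (sym posβ) (n<1+n _))
          (subst (λ z → pos (proj₁ z) U < pos (proj₂ z) U) (sym eq) (proj₂ (proj₂ (proj₂ iv))))) invL)
  P3∉ : indexOf P3 L ≡ 0
  P3∉ = indexOf-absent P3 L (All.map
    (λ {ρ} iv eq → <-asym (subst₂ _<_ (sym posβ) (sym posγ) (n<1+n _))
          (subst (λ z → pos (proj₁ z) U < pos (proj₂ z) U) (sym eq) (proj₂ (proj₂ (proj₂ iv))))) invL)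
  P3≢P1 : P3 ≢ P1
  P3≢P1 eq = <-irrefl (sym (cong proj₁ eq)) βγ
  P3≢P2 : P3 ≢ P2
  P3≢P2 eq = <-irrefl (cong proj₂ (sym eq)) αβ
  P1≢P2 : P1 ≢ P2
  P1≢P2 eq = <-irrefl (cong proj₁ eq) βγ
  P1≢P3 : P1 ≢ P3
  P1≢P3 eq = P3≢P1 (sym eq)
  s = length L
  iaP1 : indexOf P1 (swaps I0 Wa) ≡ s + 1
  iaP1 = trans (cong (indexOf P1) Sa) (trans (indexOf-++-absent P1 L ((P1 ∷ P2 ∷ P3 ∷ []) ++ M) P1∉)
    (cong (shift s) (indexOf-here P1 (P2 ∷ P3 ∷ M))))
  iaP3 : indexOf P3 (swaps I0 Wa) ≡ s + 3
  iaP3 = trans (cong (indexOf P3) Sa) (trans (indexOf-++-absent P3 L ((P1 ∷ P2 ∷ P3 ∷ []) ++ M) P3∉)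
    (cong (shift s)
           (trans (indexOf-there P3 P1 (P2 ∷ P3 ∷ M) P3≢P1)
             (cong (shift 1) (trans (indexOf-there P3 P2 (P3 ∷ M) P3≢P2)
               (cong (shift 1) (indexOf-here P3 M)))))))
  ibP3 : indexOf P3 (swaps I0 Wb) ≡ s + 1
  ibP3 = trans (cong (indexOf P3) Sb) (trans (indexOf-++-absent P3 L ((P3 ∷ P2 ∷ P1 ∷ []) ++ M) P3∉)
    (cong (shift s) (indexOf-here P3 (P2 ∷ P1 ∷ M))))
  ibP1 : indexOf P1 (swaps I0 Wb) ≡ s + 3
  ibP1 = trans (cong (indexOf P1) Sb) (trans (indexOf-++-absent P1 L ((P3 ∷ P2 ∷ P1 ∷ []) ++ M) P1∉)
    (cong (shift s)
           (trans (indexOf-there P1 P3 (P2 ∷ P1 ∷ M) P1≢P3)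
             (cong (shift 1) (trans (indexOf-there P1 P2 (P1 ∷ M) P1≢P2)
               (cong (shift 1) (indexOf-here P1 M)))))))
  Γa0 : Γ n Wa (α , β , γ) ≡ 0
  Γa0 = cong (λ b → if b then 1 else 0) (trans (cong₂ _<ᵇ_ iaP3 iaP1)
    (≥⇒<ᵇ-false (s + 3) (s + 1) (+-monoʳ-≤ s (s≤s z≤n))))
  Γb1 : Γ n Wb (α , β , γ) ≡ 1
  Γb1 = cong (λ b → if b then 1 else 0) (trans (cong₂ _<ᵇ_ ibP3 ibP1)
    (<⇒<ᵇ-true (s + 1) (s + 3) (+-monoʳ-< s (s≤s (s≤s z≤n)))))

  w = act I0 Wa
  invW : All (λ ρ → Inversion (proj₁ ρ) (proj₂ ρ) w) (L ++ ((P1 ∷ P2 ∷ P3 ∷ []) ++ M))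
  invW = subst (All (λ ρ → Inversion (proj₁ ρ) (proj₂ ρ) w)) Sa (swaps-Inversion I0 Wa (Distinct-idWord n) ra)
  blkInv = proj₂ (++⁻ L invW)
  tripW : TripleOf w α β γ
  tripW with blkInv
  ... | i1 ∷ i2 ∷ i3 ∷ _ = αβ , βγ , proj₂ (proj₂ (proj₂ i3)) , proj₂ (proj₂ (proj₂ i1))

  memU : ∀ k → InBounds k U → InRange n (get k U)
  memU k ik = Occurs-idWord⁻ n _ (Occurs-act⁻ _ I0 Y (get-Occurs k U ik))
  inα : InRange n α
  inα = memU (suc j) (s≤s z≤n , ≤-trans (n≤1+n _) v1)
  inβ : InRange n β
  inβ = memU (2 + j) (s≤s z≤n , v1)
  inγ : InRange n γ
  inγ = memU (3 + j) (s≤s z≤n , v3)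

  ≡ᵇ-triple-false : ∀ x y z → ¬ (x ≡ α × y ≡ β × z ≡ γ) → ≡ᵇ-triple α β γ (x , y , z) ≡ false
  ≡ᵇ-triple-false x y z h with x ≟ α | y ≟ β | z ≟ γ
  ... | yes refl | yes refl | yes refl = ⊥-elim (h (refl , refl , refl))
  ... | no p | _ | _ rewrite ≢⇒≡ᵇ-false x α p = refl
  ... | yes refl | no q | _ rewrite ≡ᵇ-refl x | ≢⇒≡ᵇ-false y β q = refl
  ... | yes refl | yes refl | no r rewrite ≡ᵇ-refl x | ≡ᵇ-refl y | ≢⇒≡ᵇ-false z γ r = refl

  F : ℕ → List ℕ → ℕ × ℕ × ℕ → Bool
  F g a τ = isTriple w τ ∧ not (Γ n a τ ≡ᵇ g)

  Fother : ∀ g x y z → ¬ (x ≡ α × y ≡ β × z ≡ γ) → F g Wa (x , y , z) ≡ F g Wb (x , y , z)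
  Fother g x y z nt with (x <? y) ×-dec (y <? z)
  ... | yes (xy , yz) rewrite Γ-other x y z nt = refl
  ... | no nxy rewrite ¬TripleOf⇒isTriple w x y z (λ tr → nxy (proj₁ tr , proj₁ (proj₂ tr))) = refl

  pt0 : ∀ τ → bit (F 0 Wb τ) ≡ bit (F 0 Wa τ) + bit (≡ᵇ-triple α β γ τ)
  pt0 (x , y , z) with (x ≟ α) ×-dec ((y ≟ β) ×-dec (z ≟ γ))
  ... | yes (refl , refl , refl) rewrite TripleOf⇒isTriple w α β γ tripW | Γa0 | Γb1 | ≡ᵇ-refl x | ≡ᵇ-refl y
      | ≡ᵇ-refl z = refl
  ... | no nt rewrite ≡ᵇ-triple-false x y z nt | Fother 0 x y z nt = sym (+-identityʳ _)

  pt1 : ∀ τ → bit (F 1 Wa τ) ≡ bit (F 1 Wb τ) + bit (≡ᵇ-triple α β γ τ)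
  pt1 (x , y , z) with (x ≟ α) ×-dec ((y ≟ β) ×-dec (z ≟ γ))
  ... | yes (refl , refl , refl) rewrite TripleOf⇒isTriple w α β γ tripW | Γa0 | Γb1 | ≡ᵇ-refl x | ≡ᵇ-refl y
      | ≡ᵇ-refl z = refl
  ... | no nt rewrite ≡ᵇ-triple-false x y z nt | Fother 1 x y z nt = sym (+-identityʳ _)

  mismatches₀-braid : mismatches n w Wb 0 ≡ suc (mismatches n w Wa 0)
  mismatches₀-braid = trans (count-split (F 0 Wb) (F 0 Wa) (≡ᵇ-triple α β γ) (allTriples n) pt0)
    (trans (cong (mismatches n w Wa 0 +_) (count-≡ᵇ-triple n α β γ inα inβ inγ)) (+-comm _ 1))

  mismatches₁-braid : mismatches n w Wa 1 ≡ suc (mismatches n w Wb 1)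
  mismatches₁-braid = trans (count-split (F 1 Wa) (F 1 Wb) (≡ᵇ-triple α β γ) (allTriples n) pt1)
    (trans (cong (mismatches n w Wb 1 +_) (count-≡ᵇ-triple n α β γ inα inβ inγ)) (+-comm _ 1))

-- Permutations and greedy reduced words

Perm : ℕ → List ℕ → Set
Perm n w = Distinct w × length w ≡ n × (∀ v → InRange n v → Occurs v w) × (∀ v → Occurs v w → InRange n v)

Perm-swapAt : ∀ n i w → Perm n w → Perm n (swapAt i w)
Perm-swapAt n i w (d , l , m1 , m2) = Distinct-swapAt i w d , trans (length-swapAt i w) l ,
  (λ v h → Occurs-swapAt i v w (m1 v h)) , (λ v m → m2 v (Occurs-swapAt⁻ i v w m))

Perm-id : ∀ n → Perm n (idWord n)
Perm-id n = Distinct-idWord n , length-idWord n , Occurs-idWord n , Occurs-idWord⁻ n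

Descent⇒Ascent-swapAt : ∀ i w → Descent i w → Ascent i (swapAt i w)
Descent⇒Ascent-swapAt (suc j) w (v , lt) = subst (2 + j ≤_) (sym (length-swapAt (suc j) w)) v , subst₂ _<_
  (sym (get-swapAt-fst j w v)) (sym (get-swapAt-snd j w v)) lt

Ascent⇒Descent-swapAt : ∀ i w → Ascent i w → Descent i (swapAt i w)
Ascent⇒Descent-swapAt (suc j) w (v , lt) = subst (2 + j ≤_) (sym (length-swapAt (suc j) w)) v , subst₂ _<_
  (sym (get-swapAt-snd j w v)) (sym (get-swapAt-fst j w v)) lt

NoDesc : List ℕ → Set
NoDesc w = ∀ i → ¬ Descent i w

inv≡0⇒NoDesc : ∀ w → inv w ≡ 0 → NoDesc w
inv≡0⇒NoDesc w e i d = 1+n≢0 (trans (inv-swapAt-descent i w d) e)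

NoDesc⇒idWord : ∀ n w → Perm n w → NoDesc w → w ≡ idWord n
NoDesc⇒idWord n w (d , l , m1 , m2) nd = get-extensionality w (idWord n) (trans l (sym (length-idWord n))) gk
  where
  inr : ∀ k → 1 ≤ k → k ≤ n → InRange n (get k w)
  inr k a b = m2 _ (get-Occurs k w (a , subst (k ≤_) (sym l) b))
  step : ∀ k → 1 ≤ k → suc k ≤ n → get k w < get (suc k) w
  step (suc j) a b with <-cmp (get (suc j) w) (get (2 + j) w)
  ... | tri< x _ _ = x
  ... | tri≈ _ y _ = ⊥-elim (Distinct-adjacent j w d (subst (2 + j ≤_) (sym l) b) y)
  ... | tri> _ _ z = ⊥-elim (nd (suc j) (subst (2 + j ≤_) (sym l) b , z))
  lower : ∀ k → 1 ≤ k → k ≤ n → k ≤ get k w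
  lower (suc zero) a b = proj₁ (inr 1 a b)
  lower (suc (suc k)) a b = ≤-trans (s≤s (lower (suc k) (s≤s z≤n) (≤-trans (n≤1+n _) b)))
    (step (suc k) (s≤s z≤n) b)
  upper : ∀ r k → k + r ≡ n → 1 ≤ k → get k w ≤ k
  upper zero k e a = subst (get k w ≤_) (trans (sym e) (+-identityʳ k))
    (proj₂ (inr k a (≤-reflexive (trans (sym (+-identityʳ k)) e))))
  upper (suc r) k e a = ≤-pred (≤-trans (step k a h) (upper r (suc k) e2 (s≤s z≤n)))
    where
    e2 : suc (k + r) ≡ n
    e2 = trans (sym (+-suc k r)) e
    h : suc k ≤ n
    h = subst (suc k ≤_) e2 (s≤s (m≤m+n k r))
  gk : ∀ k → get k w ≡ get k (idWord n)
  gk zero = refl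
  gk (suc k) with suc k ≤? n
  ... | yes b = trans (≤-antisym (upper (n ∸ suc k) (suc k) (m+[n∸m]≡n b) (s≤s z≤n))
      (lower (suc k) (s≤s z≤n) b))
                      (sym (get-idWord n (suc k) (s≤s z≤n , subst (suc k ≤_) (sym (length-idWord n)) b)))
  ... | no nb = trans (get-beyond (suc k) w (subst (_< suc k) (sym l) (≰⇒> nb)))
                      (sym (get-beyond (suc k) (idWord n) (subst (_< suc k) (sym (length-idWord n))
                        (≰⇒> nb))))

greedy : (List ℕ → ℕ) → List ℕ → List ℕ
greedy c w = reverse (descents c (inv w) w)

greedy-inv≡0 : ∀ c w → inv w ≡ 0 → greedy c w ≡ []
greedy-inv≡0 c w e rewrite e = refl

greedy-unfold-at : ∀ c u d → c u ≡ d → Descent d u → greedy c u ≡ greedy c (swapAt d u) ∷ʳ d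
greedy-unfold-at c u _ refl du rewrite sym (inv-swapAt-descent (c u) u du) =
  unfold-reverse (c u) (descents c (inv (swapAt (c u) u)) (swapAt (c u) u))

Reduced-∷ʳ : ∀ n w a k → Reduced n w a → Ascent k w → Reduced n (swapAt k w) (a ∷ʳ k)
Reduced-∷ʳ n w a k r asc = subst (λ W → Reduced n W (a ∷ʳ k)) acted
  (Red→Reduced n (a ∷ʳ k) (RedFrom-++⁺ (idWord n) a (k ∷ []) (Reduced→Red n w a r)
    (subst (λ W → RedFrom W (k ∷ [])) (sym (proj₁ (proj₂ r))) (asc , unit))))
  where
  acted : act (idWord n) (a ∷ʳ k) ≡ swapAt k w
  acted = trans (act-++ (idWord n) a (k ∷ [])) (cong (swapAt k) (proj₁ (proj₂ r)))

Reduced-∷ʳ⁻ : ∀ n w a k → Reduced n w (a ∷ʳ k) → Reduced n (swapAt k w) a × Descent k w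
Reduced-∷ʳ⁻ n w a k r = subst (λ W → Reduced n W a) before (Red→Reduced n a (proj₁ split)) ,
  subst (Descent k) after (Ascent⇒Descent-swapAt k _ (proj₁ (proj₂ split)))
  where
  split = RedFrom-++⁻ (idWord n) a (k ∷ []) (Reduced→Red n w (a ∷ʳ k) r)
  after : swapAt k (act (idWord n) a) ≡ w
  after = trans (sym (act-++ (idWord n) a (k ∷ []))) (proj₁ (proj₂ r))
  before : act (idWord n) a ≡ swapAt k w
  before = trans (sym (swapAt-involutive k _)) (cong (swapAt k) after)

inv-swapAt-Descent-suc : ∀ {m} k w → Descent k w → inv w ≡ suc m → inv (swapAt k w) ≡ m
inv-swapAt-Descent-suc k w dk e = suc-injective (trans (inv-swapAt-descent k w dk) e)

module Greedy (n : ℕ) (c : List ℕ → ℕ) (c-Descent : ∀ w → Perm n w → 1 ≤ inv w → Descent (c w) w) where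

  greedy-Reduced-inv : ∀ m w → inv w ≡ m → Perm n w → Reduced n w (greedy c w)
  greedy-Reduced-inv zero w e p rewrite greedy-inv≡0 c w e | NoDesc⇒idWord n w p (inv≡0⇒NoDesc w e) =
    [] , refl , sym (inv-idWord n)
  greedy-Reduced-inv (suc m) w e p =
    subst (Reduced n w) (sym (greedy-unfold-at c w (c w) refl dc))
      (subst (λ W → Reduced n W (greedy c (swapAt (c w) w) ∷ʳ c w)) (swapAt-involutive (c w) w)
        (Reduced-∷ʳ n _ _ (c w)
          (greedy-Reduced-inv m (swapAt (c w) w) (inv-swapAt-Descent-suc (c w) w dc e)
            (Perm-swapAt n (c w) w p))
          (Descent⇒Ascent-swapAt (c w) w dc)))
    where
    dc = c-Descent w p (subst (1 ≤_) (sym e) (s≤s z≤n))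

  greedy-Reduced : ∀ w → Perm n w → Reduced n w (greedy c w)
  greedy-Reduced w p = greedy-Reduced-inv (inv w) w refl p

Descent-∷ : ∀ x j u → Descent (suc j) u → Descent (2 + j) (x ∷ u)
Descent-∷ x j u (v , lt) = s≤s v , lt

Descent-∷⁻ : ∀ x j u → Descent (2 + j) (x ∷ u) → Descent (suc j) u
Descent-∷⁻ x j u (s≤s v , lt) = v , lt

NoDesc-short : ∀ i u → length u < 2 → ¬ Descent i u
NoDesc-short (suc j) u h (v , _) = 1+n≰n (≤-trans (s≤s (s≤s z≤n)) (≤-trans v (≤-pred h)))

FirstDescentSpec : List ℕ → Set
FirstDescentSpec w = NoDesc w ⊎ (Descent (firstDescent w) w × (∀ i → i < firstDescent w → ¬ Descent i w))

firstDescent-spec-∷ : ∀ x y xs → FirstDescentSpec (y ∷ xs) → FirstDescentSpec (x ∷ y ∷ xs)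
firstDescent-spec-∷ x y xs ih with y <ᵇ x in e
... | true = inj₂ ((s≤s (s≤s z≤n) , <ᵇ-true⇒< y x e) , λ { zero _ () ; (suc i) (s≤s ()) })
... | false with ih
...   | inj₁ nd = inj₁ nd′
  where
  nd′ : NoDesc (x ∷ y ∷ xs)
  nd′ zero ()
  nd′ (suc zero) (_ , lt) = true≢false (trans (sym (<⇒<ᵇ-true y x lt)) e)
  nd′ (suc (suc j)) d = nd (suc j) (Descent-∷⁻ x j (y ∷ xs) d)
...   | inj₂ (d , bef) with firstDescent (y ∷ xs) | d | bef
...     | zero | () | _
...     | suc f | d′ | bef′ = inj₂ (Descent-∷ x f (y ∷ xs) d′ , bef″)
  where
  bef″ : ∀ i → i < suc (suc f) → ¬ Descent i (x ∷ y ∷ xs)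
  bef″ zero _ ()
  bef″ (suc zero) _ (_ , lt) = true≢false (trans (sym (<⇒<ᵇ-true y x lt)) e)
  bef″ (suc (suc j)) (s≤s lt) dd = bef′ (suc j) lt (Descent-∷⁻ x j (y ∷ xs) dd)

firstDescent-spec : ∀ w → FirstDescentSpec w
firstDescent-spec [] = inj₁ (λ i → NoDesc-short i [] (s≤s z≤n))
firstDescent-spec (x ∷ []) = inj₁ (λ i → NoDesc-short i (x ∷ []) (s≤s (s≤s z≤n)))
firstDescent-spec (x ∷ y ∷ xs) = firstDescent-spec-∷ x y xs (firstDescent-spec (y ∷ xs))

firstDescent-unique : ∀ w d → Descent d w → (∀ i → i < d → ¬ Descent i w) → firstDescent w ≡ d
firstDescent-unique w d dd bef with firstDescent-spec w
... | inj₁ nd = ⊥-elim (nd d dd)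
... | inj₂ (df , beff) with <-cmp (firstDescent w) d
...   | tri< a _ _ = ⊥-elim (bef _ a df)
...   | tri≈ _ b _ = b
...   | tri> _ _ c = ⊥-elim (beff d c dd)

ascent-at : ∀ w i → Distinct w → 1 ≤ i → suc i ≤ length w → ¬ Descent i w → get i w < get (suc i) w
ascent-at w (suc j) d _ v nd with <-cmp (get (suc j) w) (get (2 + j) w)
... | tri< a _ _ = a
... | tri≈ _ b _ = ⊥-elim (Distinct-adjacent j w d v b)
... | tri> _ _ c = ⊥-elim (nd (v , c))

get-increasing-chain : ∀ w → Distinct w → ∀ r a b → a + suc r ≡ b → 1 ≤ a → b ≤ length w →
  (∀ i → a ≤ i → i < b → ¬ Descent i w) → get a w < get b w
get-increasing-chain w d zero a b e ha hb h = subst (λ B → get a w < get B w) e2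
  (ascent-at w a d ha (subst (_≤ length w) (sym e2) hb) (h a ≤-refl (subst (a <_) e2 (n<1+n a))))
  where
  e2 : suc a ≡ b
  e2 = trans (sym (trans (+-suc a 0) (cong suc (+-identityʳ a)))) e
get-increasing-chain w d (suc r) a b e ha hb h =
  <-trans (ascent-at w a d ha (≤-trans (s≤s (m≤m+n a (suc r)))
    (≤-trans (≤-reflexive (trans (sym (+-suc a (suc r))) e)) hb)) (h a ≤-refl lt1))
          (get-increasing-chain w d r (suc a) b (trans (sym (+-suc a (suc r))) e) (s≤s z≤n) hb
            (λ i l1 l2 → h i (≤-trans (n≤1+n a) l1) l2))
  where
  lt1 : a < b
  lt1 = subst (a <_) e (m<m+n a (s≤s z≤n))

get-increasing : ∀ w → Distinct w → ∀ a b → 1 ≤ a → a < b → b ≤ length w →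
  (∀ i → a ≤ i → i < b → ¬ Descent i w) → get a w < get b w
get-increasing w d a b ha ab hb h = get-increasing-chain w d (b ∸ suc a) a b
  (trans (+-suc a (b ∸ suc a)) (m+[n∸m]≡n ab)) ha hb h

Descent-swapAt-far⁻ : ∀ p k w → Far p k → Descent p (swapAt k w) → Descent p w
Descent-swapAt-far⁻ (suc a) zero w f d = d
Descent-swapAt-far⁻ (suc a) (suc b) w f (v , lt) with far-positions (suc a) (suc b) (suc a) f (inj₁ refl) |
  far-positions (suc a) (suc b) (2 + a) f (inj₂ refl)
... | (n1 , n2) | (m1 , m2) = subst (2 + a ≤_) (length-swapAt (suc b) w) v , subst₂ _<_
    (get-swapAt-other b (2 + a) w m1 m2) (get-swapAt-other b (suc a) w n1 n2) lt

Descent-swapAt-far : ∀ p k w → Far p k → Descent p w → Descent p (swapAt k w)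
Descent-swapAt-far p k w f d = Descent-swapAt-far⁻ p k (swapAt k w) f
  (subst (Descent p) (sym (swapAt-involutive k w)) d)

Descent-bounds : ∀ i w → Descent i w → 1 ≤ i × suc i ≤ length w
Descent-bounds (suc j) w (v , _) = s≤s z≤n , v

σ-cases : ∀ a i → σ a i ≡ i ⊎ σ a i ≡ suc a ⊎ σ a i ≡ 2 + a
σ-cases a i with σview a i
... | at-fst refl = inj₂ (inj₂ (σ-fst a))
... | at-snd refl = inj₂ (inj₁ (σ-snd a))
... | elsewhere p q = inj₁ (σ-other a i p q)

σ-positive : ∀ a i → 1 ≤ i → 1 ≤ σ a i
σ-positive a i h with σ-cases a i
... | inj₁ e = subst (1 ≤_) (sym e) h
... | inj₂ (inj₁ e) = subst (1 ≤_) (sym e) (s≤s z≤n)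
... | inj₂ (inj₂ e) = subst (1 ≤_) (sym e) (s≤s z≤n)

firstDescent-Descent : ∀ n w → Perm n w → 1 ≤ inv w → Descent (firstDescent w) w
firstDescent-Descent n w p h with firstDescent-spec w
... | inj₂ (d , _) = d
... | inj₁ nd = ⊥-elim (1+n≰n (≤-trans h
    (≤-reflexive (trans (cong inv (NoDesc⇒idWord n w p nd)) (inv-idWord n)))))

Descent-get : ∀ i w → Descent i w → get (suc i) w < get i w
Descent-get (suc j) w (v , lt) = lt

≡⇒∼ : ∀ {a b} → a ≡ b → a ∼ b
≡⇒∼ refl = ε

∼-swap-last : ∀ u j d → Far j d → ((u ++ j ∷ []) ++ d ∷ []) ∼ ((u ++ d ∷ []) ++ j ∷ [])
∼-swap-last u j d f = subst₂ _∼_ (sym (++-assoc u (j ∷ []) (d ∷ []))) (sym (++-assoc u (d ∷ []) (j ∷ [])))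
  (comm u [] j d (Far⇒gap f) ◅ ε)

∷ʳ-assoc₃ : ∀ (y : List ℕ) a b c → ((y ∷ʳ a) ∷ʳ b) ∷ʳ c ≡ y ++ a ∷ b ∷ c ∷ []
∷ʳ-assoc₃ y a b c = trans (++-assoc (y ∷ʳ a) (b ∷ []) (c ∷ [])) (++-assoc y (a ∷ []) (b ∷ c ∷ []))

-- g = 0 goes with the first descent and g = 1 with the last: a descent k adjacent to c w on the
-- indicated side admits a braid move lowering the number of triples with Γ ≠ g.

Adjacent : (List ℕ → ℕ) → ℕ → List ℕ → ℕ → Set
Adjacent c g w k = ((g ≡ 0 × k ≡ suc (c w)) ⊎ (g ≡ 1 × suc k ≡ c w)) ×
  greedy c (swapAt (c w) (swapAt k w)) ∼ (greedy c (swapAt k (swapAt (c w) (swapAt k w))) ∷ʳ k)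

module BraidDescent (n : ℕ) (c : List ℕ → ℕ) (g : ℕ)
  (c-Descent : ∀ w → Perm n w → 1 ≤ inv w → Descent (c w) w)
  (c-swapAt : ∀ w k → Perm n w → Descent k w → k ≢ c w →
    c (swapAt k w) ≡ c w × Descent (c w) (swapAt k w) × (Far k (c w) ⊎ Adjacent c g w k)) where

  open Greedy n c c-Descent using (greedy-Reduced)

  Improvable : List ℕ → List ℕ → Set
  Improvable w a = ∃₂ λ a′ b′ →
    a ∼ a′ × Braid a′ b′ × Reduced n w b′ × mismatches n w a′ g ≡ suc (mismatches n w b′ g)

  GreedyOrImprovable : List ℕ → List ℕ → Set
  GreedyOrImprovable w a = a ∼ greedy c w ⊎ Improvable w a

  Improvable-∼ : ∀ {w a b} → a ∼ b → Improvable w b → Improvable w a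
  Improvable-∼ s (a′ , b′ , s′ , rest) = a′ , b′ , s ◅◅ s′ , rest

  GreedyOrImprovable-∼ : ∀ {w a b} → a ∼ b → GreedyOrImprovable w b → GreedyOrImprovable w a
  GreedyOrImprovable-∼ s (inj₁ s′) = inj₁ (s ◅◅ s′)
  GreedyOrImprovable-∼ s (inj₂ imp) = inj₂ (Improvable-∼ s imp)

  greedy-∷ʳ-Reduced : ∀ w k → Perm n w → Descent k w → Reduced n w (greedy c (swapAt k w) ∷ʳ k)
  greedy-∷ʳ-Reduced w k p dk = subst (λ W → Reduced n W (greedy c (swapAt k w) ∷ʳ k)) (swapAt-involutive k w)
    (Reduced-∷ʳ n _ _ k (greedy-Reduced (swapAt k w) (Perm-swapAt n k w p)) (Descent⇒Ascent-swapAt k w dk))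

  mismatches-∷ʳ : ∀ w k a b → Perm n w → Ascent k w → Reduced n w a → Reduced n w b →
    mismatches n w a g ≡ suc (mismatches n w b g) →
    mismatches n (swapAt k w) (a ∷ʳ k) g ≡ suc (mismatches n (swapAt k w) (b ∷ʳ k) g)
  mismatches-∷ʳ w (suc j) a b (d , _ , occ , _) asc ra rb h =
    +-cancelʳ-≡ (mismatches n w b g) _ _ (begin
      mismatches n (swapAt (suc j) w) (a ∷ʳ suc j) g + mismatches n w b g
        ≡⟨ AppendLetterCount.mismatches-snoc n w j d asc occ a b
             (Reduced→Red n w a ra) (proj₁ (proj₂ ra)) (Reduced→Red n w b rb) (proj₁ (proj₂ rb)) g ⟩
      mismatches n (swapAt (suc j) w) (b ∷ʳ suc j) g + mismatches n w a g
        ≡⟨ cong (mismatches n (swapAt (suc j) w) (b ∷ʳ suc j) g +_) h ⟩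
      mismatches n (swapAt (suc j) w) (b ∷ʳ suc j) g + suc (mismatches n w b g)
        ≡⟨ +-suc _ _ ⟩
      suc (mismatches n (swapAt (suc j) w) (b ∷ʳ suc j) g) + mismatches n w b g ∎)
    where open ≡-Reasoning

  Improvable-∷ʳ : ∀ w k a → Perm n w → Descent k w → Improvable (swapAt k w) a → Improvable w (a ∷ʳ k)
  Improvable-∷ʳ w k a p dk (a′ , b′ , s , br , rb , h) =
    a′ ∷ʳ k , b′ ∷ʳ k , ∼-++ʳ a a′ (k ∷ []) s , Braid-++ʳ a′ b′ (k ∷ []) br ,
    subst (λ W → Reduced n W (b′ ∷ʳ k)) back (Reduced-∷ʳ n _ b′ k rb asc) ,
    subst (λ W → mismatches n W (a′ ∷ʳ k) g ≡ suc (mismatches n W (b′ ∷ʳ k) g)) back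
      (mismatches-∷ʳ (swapAt k w) k a′ b′ (Perm-swapAt n k w p) asc ra rb h)
    where
    back = swapAt-involutive k w
    asc = Descent⇒Ascent-swapAt k w dk
    ra = Reduced-Braid n _ b′ a′ (Braid-sym a′ b′ br) rb

  GreedyOrImprovable-∷ʳ-chosen : ∀ w a → Perm n w → Descent (c w) w → GreedyOrImprovable (swapAt (c w) w) a →
    GreedyOrImprovable w (a ∷ʳ c w)
  GreedyOrImprovable-∷ʳ-chosen w a p dc (inj₁ s) =
    inj₁ (∼-++ʳ a _ (c w ∷ []) s ◅◅ ≡⇒∼ (sym (greedy-unfold-at c w (c w) refl dc)))
  GreedyOrImprovable-∷ʳ-chosen w a p dc (inj₂ imp) = inj₂ (Improvable-∷ʳ w (c w) a p dc imp)

  braid-Improvable₀ : ∀ w y d → g ≡ 0 → Reduced n w (y ++ suc d ∷ d ∷ suc d ∷ []) →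
    Improvable w (y ++ suc d ∷ d ∷ suc d ∷ [])
  braid-Improvable₀ w y zero _ (ls , _) with ++⁻ y ls
  ... | _ , _ ∷ (() , _) ∷ _
  braid-Improvable₀ w y (suc j) g≡0 rb = Wb , Wa , ε , br , ra ,
    subst₂ (λ G W → mismatches n W Wb G ≡ suc (mismatches n W Wa G)) (sym g≡0) (proj₁ (proj₂ ra))
      B.mismatches₀-braid
    where
    Wa = y ++ suc j ∷ 2 + j ∷ suc j ∷ []
    Wb = y ++ 2 + j ∷ suc j ∷ 2 + j ∷ []
    br : Braid Wb Wa
    br = braidDown y [] (suc j)
    ra : Reduced n w Wa
    ra = Reduced-Braid n w Wb Wa br rb
    module B = BraidFlip n y [] j (Reduced→Red n w Wa ra) (Reduced→Red n w Wb rb)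

  braid-Improvable₁ : ∀ w y k → g ≡ 1 → Reduced n w (y ++ k ∷ suc k ∷ k ∷ []) →
    Improvable w (y ++ k ∷ suc k ∷ k ∷ [])
  braid-Improvable₁ w y zero _ (ls , _) with ++⁻ y ls
  ... | _ , (() , _) ∷ _
  braid-Improvable₁ w y (suc j) g≡1 ra = Wa , Wb , ε , br , rb ,
    subst₂ (λ G W → mismatches n W Wa G ≡ suc (mismatches n W Wb G)) (sym g≡1) (proj₁ (proj₂ ra))
      B.mismatches₁-braid
    where
    Wa = y ++ suc j ∷ 2 + j ∷ suc j ∷ []
    Wb = y ++ 2 + j ∷ suc j ∷ 2 + j ∷ []
    br : Braid Wa Wb
    br = braidUp y [] (suc j)
    rb : Reduced n w Wb
    rb = Reduced-Braid n w Wa Wb br ra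
    module B = BraidFlip n y [] j (Reduced→Red n w Wa ra) (Reduced→Red n w Wb rb)

  Level : ℕ → Set
  Level m = ∀ w a → inv w ≡ m → Perm n w → Reduced n w a → GreedyOrImprovable w a

  greedy-∷ʳ-far : ∀ {m} → Level m → ∀ w k → inv w ≡ suc m → Perm n w → Descent k w → c (swapAt k w) ≡ c w →
    Descent (c w) (swapAt k w) → Far k (c w) → GreedyOrImprovable w (greedy c (swapAt k w) ∷ʳ k)
  greedy-∷ʳ-far ih w k e p dk cc dc far =
    GreedyOrImprovable-∼ reorder
      (GreedyOrImprovable-∷ʳ-chosen w x p dcw (ih v x (inv-swapAt-Descent-suc (c w) w dcw e) pv rx))
    where
    d = c w
    v = swapAt d w
    pv = Perm-swapAt n d w p
    dcw : Descent d w
    dcw = Descent-swapAt-far⁻ d k w (Far-sym far) dc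
    x = greedy c (swapAt k v) ∷ʳ k
    rx : Reduced n v x
    rx = greedy-∷ʳ-Reduced v k pv (Descent-swapAt-far k d w far dk)
    reorder : (greedy c (swapAt k w) ∷ʳ k) ∼ (x ∷ʳ d)
    reorder = subst (λ W → (greedy c (swapAt k w) ∷ʳ k) ∼ ((greedy c W ∷ʳ k) ∷ʳ d))
                (swapAt-comm-far d k w (Far-sym far))
                (≡⇒∼ (cong (_∷ʳ k) (greedy-unfold-at c (swapAt k w) d cc dc))
                  ◅◅ ∼-swap-last (greedy c (swapAt d (swapAt k w))) d k (Far-sym far))

  greedy-∷ʳ-adjacent : ∀ w k → Perm n w → Descent k w → c (swapAt k w) ≡ c w → Descent (c w) (swapAt k w) →
    Adjacent c g w k → Improvable w (greedy c (swapAt k w) ∷ʳ k)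
  greedy-∷ʳ-adjacent w k p dk cc dc (side , s) = Improvable-∼ reorder (by-side side)
    where
    d = c w
    y = greedy c (swapAt k (swapAt d (swapAt k w)))
    reorder : (greedy c (swapAt k w) ∷ʳ k) ∼ (y ++ k ∷ d ∷ k ∷ [])
    reorder = ≡⇒∼ (cong (_∷ʳ k) (greedy-unfold-at c (swapAt k w) d cc dc))
      ◅◅ subst ((greedy c (swapAt d (swapAt k w)) ∷ʳ d ∷ʳ k) ∼_) (∷ʳ-assoc₃ y k d k)
           (∼-++ʳ _ _ (k ∷ []) (∼-++ʳ _ _ (d ∷ []) s))
    rw : Reduced n w (y ++ k ∷ d ∷ k ∷ [])
    rw = Reduced-∼ n w _ _ reorder (greedy-∷ʳ-Reduced w k p dk)
    by-side : (g ≡ 0 × k ≡ suc d) ⊎ (g ≡ 1 × suc k ≡ d) → Improvable w (y ++ k ∷ d ∷ k ∷ [])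
    by-side (inj₁ (g≡0 , k≡)) = subst (λ K → Improvable w (y ++ K ∷ d ∷ K ∷ [])) (sym k≡)
      (braid-Improvable₀ w y d g≡0 (subst (λ K → Reduced n w (y ++ K ∷ d ∷ K ∷ [])) k≡ rw))
    by-side (inj₂ (g≡1 , d≡)) = subst (λ D → Improvable w (y ++ k ∷ D ∷ k ∷ [])) d≡
      (braid-Improvable₁ w y k g≡1 (subst (λ D → Reduced n w (y ++ k ∷ D ∷ k ∷ [])) (sym d≡) rw))

  greedy-∷ʳ : ∀ {m} → Level m → ∀ w k → inv w ≡ suc m → Perm n w → Descent k w →
    GreedyOrImprovable w (greedy c (swapAt k w) ∷ʳ k)
  greedy-∷ʳ ih w k e p dk with k ≟ c w
  ... | yes refl = inj₁ (≡⇒∼ (sym (greedy-unfold-at c w k refl dk)))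
  ... | no k≢c with c-swapAt w k p dk k≢c
  ...   | cc , dc , inj₁ far = greedy-∷ʳ-far ih w k e p dk cc dc far
  ...   | cc , dc , inj₂ adj = inj₂ (greedy-∷ʳ-adjacent w k p dk cc dc adj)

  greedyOrImprovable : ∀ m → Level m
  greedyOrImprovable zero w [] e p r = inj₁ (≡⇒∼ (sym (greedy-inv≡0 c w e)))
  greedyOrImprovable zero w (i ∷ a) e p (_ , _ , l) = ⊥-elim (1+n≢0 (trans l e))
  greedyOrImprovable (suc m) w a e p r with initLast a
  ... | [] = ⊥-elim (1+n≢0 (trans (sym e) (sym (proj₂ (proj₂ r)))))
  ... | a₁ ∷ʳ′ k with Reduced-∷ʳ⁻ n w a₁ k r
  ...   | r₁ , dk with greedyOrImprovable m (swapAt k w) a₁ (inv-swapAt-Descent-suc k w dk e)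
      (Perm-swapAt n k w p) r₁
  ...     | inj₁ s = GreedyOrImprovable-∼ (∼-++ʳ a₁ _ (k ∷ []) s)
      (greedy-∷ʳ (greedyOrImprovable m) w k e p dk)
  ...     | inj₂ imp = inj₂ (Improvable-∷ʳ w k a₁ p dk imp)

-- First descents and a_min

-- As long as the entries left of position j stay below v_j, each first descent chosen before j is
-- at distance ≥ 2 from j, so its letter commutes with j.
greedy-firstDescent-∼ : ∀ n m v j → inv v ≡ m → Perm n v → Descent j v →
  (∀ i → 1 ≤ i → i < j → get i v < get j v) →
  greedy firstDescent v ∼ (greedy firstDescent (swapAt j v) ++ j ∷ [])
greedy-firstDescent-∼ n m v j e p dj hyp with firstDescent-spec v
... | inj₁ nd = ⊥-elim (nd j dj)
... | inj₂ (d0v , bef0) with <-cmp (firstDescent v) j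
...   | tri> _ _ c = ⊥-elim (bef0 j c dj)
...   | tri≈ _ b _ = ≡⇒∼ (subst (λ J → greedy firstDescent v ≡ greedy firstDescent (swapAt J v) ++ J ∷ []) b
    (greedy-unfold-at firstDescent v (firstDescent v) refl d0v))
...   | tri< lt _ _ = main-step m e
  where
  d0 = firstDescent v
  vd0 = Descent-bounds d0 v d0v
  far0 : 2 + d0 ≤ j
  far0 with m≤n⇒m<n∨m≡n lt
  ... | inj₁ x = x
  ... | inj₂ x = ⊥-elim (<-asym (hyp d0 (proj₁ vd0) lt)
      (subst (λ J → get J v < get d0 v) x (Descent-get d0 v d0v)))
  v1 = swapAt d0 v
  main-step : ∀ m → inv v ≡ m → greedy firstDescent v ∼ (greedy firstDescent (swapAt j v) ++ j ∷ [])
  main-step zero e0 = ⊥-elim (1+n≢0 (trans (inv-swapAt-descent d0 v d0v) e0))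
  main-step (suc m) e0 = subst (λ W → greedy firstDescent v ∼ W) (sym fin)
    (subst (_∼ ((greedy firstDescent (swapAt j v1) ++ d0 ∷ []) ++ j ∷ [])) (sym st0)
                          (∼-++ʳ _ _ (d0 ∷ []) ih ◅◅ ∼-swap-last (greedy firstDescent (swapAt j v1)) j d0
                            (inj₂ far0)))
    where
    e1 : inv v1 ≡ m
    e1 = suc-injective (trans (inv-swapAt-descent d0 v d0v) e0)
    st0 : greedy firstDescent v ≡ greedy firstDescent v1 ++ d0 ∷ []
    st0 = greedy-unfold-at firstDescent v d0 refl d0v
    dj1 : Descent j v1
    dj1 = Descent-swapAt-far j d0 v (inj₂ far0) dj
    vj = Descent-bounds j v dj
    hyp1 : ∀ i → 1 ≤ i → i < j → get i v1 < get j v1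
    hyp1 i hi lti with d0 | far0 | vd0
    ... | suc a | f | (_ , vv) = subst₂ _<_ (sym (get-swapAt a i v vv)) (sym gj2)
        (hyp (σ a i) (σ-positive a i hi) σlt)
      where
      gj2 : get j (swapAt (suc a) v) ≡ get j v
      gj2 = get-swapAt-other a j v (λ x → 1+n≰n (≤-trans (n≤1+n _) (≤-trans f (≤-reflexive x))))
                      (λ x → 1+n≰n (≤-trans f (≤-reflexive x)))
      σlt : σ a i < j
      σlt with σ-cases a i
      ... | inj₁ x = subst (_< j) (sym x) lti
      ... | inj₂ (inj₁ x) = subst (_< j) (sym x) (≤-trans (s≤s (n≤1+n _)) f)
      ... | inj₂ (inj₂ x) = subst (_< j) (sym x) f
    ih : greedy firstDescent v1 ∼ (greedy firstDescent (swapAt j v1) ++ j ∷ [])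
    ih = greedy-firstDescent-∼ n m v1 j e1 (Perm-swapAt n d0 v p) dj1 hyp1
    dd2 : Descent d0 (swapAt j v)
    dd2 = Descent-swapAt-far d0 j v (inj₁ far0) d0v
    fd2 : firstDescent (swapAt j v) ≡ d0
    fd2 = firstDescent-unique (swapAt j v) d0 dd2
      (λ i lti di → bef0 i lti (Descent-swapAt-far⁻ i j v (inj₁ (≤-trans (+-monoʳ-≤ 2 (<⇒≤ lti)) far0)) di))
    fin : greedy firstDescent (swapAt j v) ++ j ∷ [] ≡
      (greedy firstDescent (swapAt j v1) ++ d0 ∷ []) ++ j ∷ []
    fin = cong (_++ j ∷ []) (trans (greedy-unfold-at firstDescent (swapAt j v) d0 fd2 dd2)
      (cong (λ W → greedy firstDescent W ++ d0 ∷ []) (swapAt-comm-far d0 j v (inj₁ far0))))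

firstDescent-swapAt : ∀ n w k → Perm n w → Descent k w → k ≢ firstDescent w →
  firstDescent (swapAt k w) ≡ firstDescent w × Descent (firstDescent w) (swapAt k w) ×
    (Far k (firstDescent w) ⊎ Adjacent firstDescent 0 w k)
firstDescent-swapAt n w k p dk ne with firstDescent-spec w
... | inj₁ nd = ⊥-elim (nd k dk)
... | inj₂ (dd , bef) with <-cmp k (firstDescent w)
...   | tri< a _ _ = ⊥-elim (bef k a dk)
...   | tri≈ _ b _ = ⊥-elim (ne b)
...   | tri> _ _ c with m≤n⇒m<n∨m≡n c
...     | inj₁ far = firstDescent-unique (swapAt k w) (firstDescent w) dd2
    (λ i lti di → bef i lti (Descent-swapAt-far⁻ i k w (inj₁ (≤-trans (+-monoʳ-≤ 2 (<⇒≤ lti)) far)) di)) ,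
                   dd2 , inj₁ (inj₂ far)
  where
  dd2 : Descent (firstDescent w) (swapAt k w)
  dd2 = Descent-swapAt-far (firstDescent w) k w (inj₁ far) dd
...     | inj₂ adj = adjcase (firstDescent w) refl dd bef k (sym adj) dk
  where
  adjcase : ∀ d → firstDescent w ≡ d → Descent d w → (∀ i → i < d → ¬ Descent i w) → ∀ k → k ≡ suc d →
    Descent k w → firstDescent (swapAt k w) ≡ firstDescent w × Descent (firstDescent w) (swapAt k w) ×
      (Far k (firstDescent w) ⊎ Adjacent firstDescent 0 w k)
  adjcase (suc j) fdw (vd , ltd) bef .(2 + j) refl (vk , ltk) =
    trans fd2 (sym fdw) , subst (λ D → Descent D w2) (sym fdw) dd2 , inj₂
      (inj₁ (refl , cong suc (sym fdw)) , subst
        (λ D → greedy firstDescent (swapAt D (swapAt (2 + j) w)) ∼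
          (greedy firstDescent (swapAt (2 + j) (swapAt D (swapAt (2 + j) w))) ++ (2 + j) ∷ [])) (sym fdw)
        (greedy-firstDescent-∼ n (inv w3) w3 (2 + j) refl
          (Perm-swapAt n (suc j) _ (Perm-swapAt n (2 + j) w p)) dk3 hyp))
    where
    dw = proj₁ p
    w2 = swapAt (2 + j) w
    w3 = swapAt (suc j) w2
    vk2 : 2 + j ≤ length w2
    vk2 = subst (2 + j ≤_) (sym (length-swapAt (2 + j) w)) vd
    g2a : get (suc j) w2 ≡ get (suc j) w
    g2a = get-swapAt-other (suc j) (suc j) w n≢1+n n≢2+n
    g2b : get (2 + j) w2 ≡ get (3 + j) w
    g2b = get-swapAt-fst (suc j) w vk
    dd2 : Descent (suc j) w2
    dd2 = vk2 , subst₂ _<_ (sym g2b) (sym g2a) (<-trans ltk ltd)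
    fd2 : firstDescent w2 ≡ suc j
    fd2 = firstDescent-unique w2 (suc j) dd2
      (λ i lti di → bef i lti (Descent-swapAt-far⁻ i (2 + j) w (inj₁ (s≤s (s≤s (≤-pred lti)))) di))
    g3a : get (2 + j) w3 ≡ get (suc j) w
    g3a = trans (get-swapAt-snd j w2 vk2) g2a
    g3b : get (3 + j) w3 ≡ get (2 + j) w
    g3b = trans (get-swapAt-other j (3 + j) w2 (λ e → n≢2+n (sym e)) (λ e → n≢1+n (sym e)))
      (get-swapAt-snd (suc j) w vk)
    g3c : get (suc j) w3 ≡ get (3 + j) w
    g3c = trans (get-swapAt-fst j w2 vk2) g2b
    dk3 : Descent (2 + j) w3
    dk3 = subst (3 + j ≤_) (sym (trans (length-swapAt (suc j) w2) (length-swapAt (2 + j) w))) vk , subst₂ _<_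
      (sym g3b) (sym g3a) ltd
    hyp : ∀ i → 1 ≤ i → i < 2 + j → get i w3 < get (2 + j) w3
    hyp i hi lti with m≤n⇒m<n∨m≡n lti
    ... | inj₂ e rewrite suc-injective e | g3c | g3a = <-trans ltk ltd
    ... | inj₁ lt2 rewrite g3a = subst (_< get (suc j) w) (sym gi)
        (get-increasing w dw i (suc j) hi (≤-pred lt2) (≤-trans (n≤1+n _) vd) (λ i2 _ l2 → bef i2 l2))
      where
      gi : get i w3 ≡ get i w
      gi = trans (get-swapAt-other j i w2 (λ e → <-irrefl e (≤-pred lt2))
        (λ e → <-irrefl e (≤-trans (≤-pred lt2) (n≤1+n _))))
                 (get-swapAt-other (suc j) i w (λ e → <-irrefl e (≤-trans (≤-pred lt2) (n≤1+n _)))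
                   (λ e → <-irrefl e (≤-trans (≤-pred lt2) (≤-trans (n≤1+n _) (n≤1+n _)))))

pos-idWord : ∀ n v → InRange n v → pos v (idWord n) ≡ v
pos-idWord n v h = trans (cong (λ z → pos z (idWord n)) (sym (get-idWord n v ix)))
  (pos-get (idWord n) (Distinct-idWord n) v ix)
  where
  ix : InBounds v (idWord n)
  ix = proj₁ h , subst (v ≤_) (sym (length-idWord n)) (proj₂ h)

¬TripleOf-idWord : ∀ n a1 a2 a3 → InRange n a2 → InRange n a3 → ¬ TripleOf (idWord n) a1 a2 a3
¬TripleOf-idWord n a1 a2 a3 h2 h3 (_ , l23 , pa , _) = <-asym l23
  (subst₂ _<_ (pos-idWord n a3 h3) (pos-idWord n a2 h2) pa)

Γ-amin : ∀ n m w → inv w ≡ m → Perm n w → ∀ a1 a2 a3 → InRange n a1 → InRange n a2 → InRange n a3 →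
  TripleOf w a1 a2 a3 → Γ n (amin w) (a1 , a2 , a3) ≡ 0
Γ-amin n zero w e p a1 a2 a3 h1 h2 h3 t = ⊥-elim
  (¬TripleOf-idWord n a1 a2 a3 h2 h3 (subst (λ W → TripleOf W a1 a2 a3)
    (NoDesc⇒idWord n w p (inv≡0⇒NoDesc w e)) t))
Γ-amin n (suc m) w e p a1 a2 a3 h1 h2 h3 t with firstDescent-spec w
... | inj₁ nd = ⊥-elim (¬TripleOf-idWord n a1 a2 a3 h2 h3
    (subst (λ W → TripleOf W a1 a2 a3) (NoDesc⇒idWord n w p nd) t))
... | inj₂ (dd0 , bef0) = stepΓ (firstDescent w) refl dd0 bef0
  where
  stepΓ : ∀ d → firstDescent w ≡ d → Descent d w → (∀ i → i < firstDescent w → ¬ Descent i w) →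
    Γ n (amin w) (a1 , a2 , a3) ≡ 0
  stepΓ (suc j) fdw dd bef = subst (λ X → Γ n X (a1 , a2 , a3) ≡ 0)
    (sym (greedy-unfold-at firstDescent w (suc j) fdw dd)) res
    where
    w1 = swapAt (suc j) w
    asc : Ascent (suc j) w1
    asc = Descent⇒Ascent-swapAt (suc j) w dd
    p1 : Perm n w1
    p1 = Perm-swapAt n (suc j) w p
    inv1 : inv w1 ≡ m
    inv1 = suc-injective (trans (inv-swapAt-descent (suc j) w dd) e)
    module AF = Greedy n firstDescent (firstDescent-Descent n)
    r1 = AF.greedy-Reduced w1 p1
    module T = AppendLetter n w1 j (proj₁ p1) asc (proj₁ (proj₂ (proj₂ p1)))
    module TW = T.Before (amin w1) (Reduced→Red n w1 (amin w1) r1) (proj₁ (proj₂ r1))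
    eW : T.W ≡ w
    eW = swapAt-involutive (suc j) w
    tW : TripleOf T.W a1 a2 a3
    tW = subst (λ W → TripleOf W a1 a2 a3) (sym eW) t
    vd = proj₁ dd
    res : Γ n (amin w1 ++ suc j ∷ []) (a1 , a2 , a3) ≡ 0
    res with TripleOf? w1 a1 a2 a3
    ... | yes t1 = trans (proj₂ (TW.old-triple a1 a2 a3 h1 h2 h3 t1))
        (Γ-amin n m w1 inv1 p1 a1 a2 a3 h1 h2 h3 t1)
    ... | no t1 with TW.new-triple a1 a2 a3 h1 h2 h3 tW t1
    ...   | inj₁ (_ , g0) = g0
    ...   | inj₂ (eq2 , _) = ⊥-elim (<-asym (proj₁ (proj₂ t)) lt)
      where
      a2e : a2 ≡ get (suc j) w
      a2e = trans (cong proj₁ eq2) (get-swapAt-snd j w vd)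
      pa2 : pos a2 w ≡ suc j
      pa2 = trans (cong (λ z → pos z w) a2e) (pos-get w (proj₁ p) (suc j) (s≤s z≤n , ≤-trans (n≤1+n _) vd))
      mem3 : Occurs a3 w
      mem3 = proj₁ (proj₂ (proj₂ p)) a3 h3
      gp3 = get-pos a3 w mem3
      lt3 : pos a3 w < suc j
      lt3 = subst (pos a3 w <_) pa2 (proj₁ (proj₂ (proj₂ t)))
      lt : a3 < a2
      lt = subst₂ _<_ (proj₁ gp3) (sym a2e) (get-increasing w (proj₁ p) (pos a3 w) (suc j)
        (proj₁ (proj₂ gp3)) lt3 (≤-trans (n≤1+n _) vd)
             (λ i _ l → bef i (subst (i <_) (sym fdw) l)))

-- Last descents and a_max

LastDescentSpec : List ℕ → Set
LastDescentSpec w = (NoDesc w × lastDescent w ≡ 0) ⊎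
  (Descent (lastDescent w) w × (∀ i → lastDescent w < i → ¬ Descent i w))

lastDescent-spec-∷ : ∀ x y xs → LastDescentSpec (y ∷ xs) → LastDescentSpec (x ∷ y ∷ xs)
lastDescent-spec-∷ x y xs ih with lastDescent (y ∷ xs) | ih
... | zero | inj₂ (() , _)
... | suc k | inj₁ (_ , ())
... | suc k | inj₂ (d , aft) = inj₂ (Descent-∷ x k (y ∷ xs) d , aft2)
  where
  aft2 : ∀ i → suc (suc k) < i → ¬ Descent i (x ∷ y ∷ xs)
  aft2 (suc (suc j)) (s≤s lt) dd = aft (suc j) lt (Descent-∷⁻ x j (y ∷ xs) dd)
... | zero | inj₁ (nd , _) with y <ᵇ x in e
...   | true = inj₂ ((s≤s (s≤s z≤n) , <ᵇ-true⇒< y x e) , aft3)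
  where
  aft3 : ∀ i → 1 < i → ¬ Descent i (x ∷ y ∷ xs)
  aft3 (suc zero) (s≤s ())
  aft3 (suc (suc j)) _ dd = nd (suc j) (Descent-∷⁻ x j (y ∷ xs) dd)
...   | false = inj₁ (nd2 , refl)
  where
  nd2 : NoDesc (x ∷ y ∷ xs)
  nd2 zero ()
  nd2 (suc zero) (_ , lt) = true≢false (trans (sym (<⇒<ᵇ-true y x lt)) e)
  nd2 (suc (suc j)) d = nd (suc j) (Descent-∷⁻ x j (y ∷ xs) d)

lastDescent-spec : ∀ w → LastDescentSpec w
lastDescent-spec [] = inj₁ ((λ i → NoDesc-short i [] (s≤s z≤n)) , refl)
lastDescent-spec (x ∷ []) = inj₁ ((λ i → NoDesc-short i (x ∷ []) (s≤s (s≤s z≤n))) , refl)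
lastDescent-spec (x ∷ y ∷ xs) = lastDescent-spec-∷ x y xs (lastDescent-spec (y ∷ xs))

lastDescent-unique : ∀ w D → Descent D w → (∀ i → D < i → ¬ Descent i w) → lastDescent w ≡ D
lastDescent-unique w D dd aft with lastDescent-spec w
... | inj₁ (nd , _) = ⊥-elim (nd D dd)
... | inj₂ (dl , aftl) with <-cmp (lastDescent w) D
...   | tri< a _ _ = ⊥-elim (aftl D a dd)
...   | tri≈ _ b _ = b
...   | tri> _ _ c = ⊥-elim (aft _ c dl)

lastDescent-Descent : ∀ n w → Perm n w → 1 ≤ inv w → Descent (lastDescent w) w
lastDescent-Descent n w p h with lastDescent-spec w
... | inj₂ (d , _) = d
... | inj₁ (nd , _) = ⊥-elim (1+n≰n (≤-trans h
    (≤-reflexive (trans (cong inv (NoDesc⇒idWord n w p nd)) (inv-idWord n)))))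

-- Symmetrically, as long as the entries right of position j + 1 stay above v_(j+1), each last
-- descent chosen before j is at distance ≥ 2 from j.
greedy-lastDescent-∼ : ∀ n m v j → inv v ≡ m → Perm n v → Descent j v →
  (∀ i → suc j < i → i ≤ length v → get (suc j) v < get i v) →
  greedy lastDescent v ∼ (greedy lastDescent (swapAt j v) ++ j ∷ [])
greedy-lastDescent-∼ n m v j e p dj hyp with lastDescent-spec v
... | inj₁ (nd , _) = ⊥-elim (nd j dj)
... | inj₂ (d0v , aft0) with <-cmp (lastDescent v) j
...   | tri< a _ _ = ⊥-elim (aft0 j a dj)
...   | tri≈ _ b _ = ≡⇒∼ (subst (λ J → greedy lastDescent v ≡ greedy lastDescent (swapAt J v) ++ J ∷ []) b
    (greedy-unfold-at lastDescent v (lastDescent v) refl d0v))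
...   | tri> _ _ gt = main-step m e
  where
  D0 = lastDescent v
  vd0 = Descent-bounds D0 v d0v
  far0 : 2 + j ≤ D0
  far0 with m≤n⇒m<n∨m≡n gt
  ... | inj₁ x = x
  ... | inj₂ x = ⊥-elim (<-asym (hyp (suc D0) (s≤s (≤-reflexive x)) (proj₂ vd0))
      (subst (λ J → get (suc D0) v < get J v) (sym x) (Descent-get D0 v d0v)))
  v1 = swapAt D0 v
  main-step : ∀ m → inv v ≡ m → greedy lastDescent v ∼ (greedy lastDescent (swapAt j v) ++ j ∷ [])
  main-step zero e0 = ⊥-elim (1+n≢0 (trans (inv-swapAt-descent D0 v d0v) e0))
  main-step (suc m) e0 = subst (λ W → greedy lastDescent v ∼ W) (sym fin)
    (subst (_∼ ((greedy lastDescent (swapAt j v1) ++ D0 ∷ []) ++ j ∷ [])) (sym st0)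
                          (∼-++ʳ _ _ (D0 ∷ []) ih ◅◅ ∼-swap-last (greedy lastDescent (swapAt j v1)) j D0
                            (inj₁ far0)))
    where
    e1 : inv v1 ≡ m
    e1 = suc-injective (trans (inv-swapAt-descent D0 v d0v) e0)
    st0 : greedy lastDescent v ≡ greedy lastDescent v1 ++ D0 ∷ []
    st0 = greedy-unfold-at lastDescent v D0 refl d0v
    dj1 : Descent j v1
    dj1 = Descent-swapAt-far j D0 v (inj₁ far0) dj
    vj = Descent-bounds j v dj
    hyp1 : ∀ i → suc j < i → i ≤ length v1 → get (suc j) v1 < get i v1
    hyp1 i lti li with D0 | far0 | vd0
    ... | suc a | f | (_ , vv) = subst₂ _<_ (sym gj2) (sym (get-swapAt a i v vv)) (hyp (σ a i) σlt (σle))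
      where
      gj2 : get (suc j) (swapAt (suc a) v) ≡ get (suc j) v
      gj2 = get-swapAt-other a (suc j) v (λ x → 1+n≰n (≤-trans f (≤-reflexive (sym x))))
                            (λ x → 1+n≰n (≤-trans f (≤-trans (n≤1+n _) (≤-reflexive (sym x)))))
      σlt : suc j < σ a i
      σlt with σ-cases a i
      ... | inj₁ x = subst (suc j <_) (sym x) lti
      ... | inj₂ (inj₁ x) = subst (suc j <_) (sym x) f
      ... | inj₂ (inj₂ x) = subst (suc j <_) (sym x) (≤-trans f (n≤1+n _))
      σle : σ a i ≤ length v
      σle with σ-cases a i
      ... | inj₁ x = subst (_≤ length v) (sym x) (subst (i ≤_) (length-swapAt (suc a) v) li)
      ... | inj₂ (inj₁ x) = subst (_≤ length v) (sym x) (≤-trans (n≤1+n _) vv)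
      ... | inj₂ (inj₂ x) = subst (_≤ length v) (sym x) vv
    ih : greedy lastDescent v1 ∼ (greedy lastDescent (swapAt j v1) ++ j ∷ [])
    ih = greedy-lastDescent-∼ n m v1 j e1 (Perm-swapAt n D0 v p) dj1 hyp1
    dd2 : Descent D0 (swapAt j v)
    dd2 = Descent-swapAt-far D0 j v (inj₂ far0) d0v
    ld2 : lastDescent (swapAt j v) ≡ D0
    ld2 = lastDescent-unique (swapAt j v) D0 dd2
      (λ i lti di → aft0 i lti (Descent-swapAt-far⁻ i j v (inj₂ (≤-trans far0 (<⇒≤ lti))) di))
    fin : greedy lastDescent (swapAt j v) ++ j ∷ [] ≡ (greedy lastDescent (swapAt j v1) ++ D0 ∷ []) ++ j ∷ []
    fin = cong (_++ j ∷ []) (trans (greedy-unfold-at lastDescent (swapAt j v) D0 ld2 dd2)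
      (cong (λ W → greedy lastDescent W ++ D0 ∷ []) (swapAt-comm-far D0 j v (inj₂ far0))))

lastDescent-swapAt : ∀ n w k → Perm n w → Descent k w → k ≢ lastDescent w →
  lastDescent (swapAt k w) ≡ lastDescent w × Descent (lastDescent w) (swapAt k w) ×
    (Far k (lastDescent w) ⊎ Adjacent lastDescent 1 w k)
lastDescent-swapAt n w k p dk ne with lastDescent-spec w
... | inj₁ (nd , _) = ⊥-elim (nd k dk)
... | inj₂ (dd , aft) with <-cmp k (lastDescent w)
...   | tri> _ _ c = ⊥-elim (aft k c dk)
...   | tri≈ _ b _ = ⊥-elim (ne b)
...   | tri< a _ _ with m≤n⇒m<n∨m≡n a
...     | inj₁ far = lastDescent-unique (swapAt k w) (lastDescent w) dd2
    (λ i lti di → aft i lti (Descent-swapAt-far⁻ i k w (inj₂ (≤-trans far (<⇒≤ lti))) di)) ,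
                   dd2 , inj₁ (inj₁ far)
  where
  dd2 : Descent (lastDescent w) (swapAt k w)
  dd2 = Descent-swapAt-far (lastDescent w) k w (inj₂ far) dd
...     | inj₂ adj = adjcase k dk (lastDescent w) refl dd aft adj
  where
  adjcase : ∀ k → Descent k w → ∀ D → lastDescent w ≡ D → Descent D w → (∀ i → D < i → ¬ Descent i w) →
    suc k ≡ D → lastDescent (swapAt k w) ≡ lastDescent w × Descent (lastDescent w) (swapAt k w) ×
      (Far k (lastDescent w) ⊎ Adjacent lastDescent 1 w k)
  adjcase (suc j) (vk , ltk) .(2 + j) ldw (vd , ltd) aft refl =
    trans ld2 (sym ldw) , subst (λ D → Descent D w2) (sym ldw) dd2 , inj₂ (inj₂ (refl , sym ldw) ,
      subst (λ D → greedy lastDescent (swapAt D (swapAt (suc j) w)) ∼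
        (greedy lastDescent (swapAt (suc j) (swapAt D (swapAt (suc j) w))) ++ (suc j) ∷ [])) (sym ldw)
        (greedy-lastDescent-∼ n (inv w3) w3 (suc j) refl
          (Perm-swapAt n (2 + j) _ (Perm-swapAt n (suc j) w p)) dk3 hyp))
    where
    dw = proj₁ p
    w2 = swapAt (suc j) w
    w3 = swapAt (2 + j) w2
    vd2 : 3 + j ≤ length w2
    vd2 = subst (3 + j ≤_) (sym (length-swapAt (suc j) w)) vd
    g2a : get (2 + j) w2 ≡ get (suc j) w
    g2a = get-swapAt-snd j w vk
    g2b : get (3 + j) w2 ≡ get (3 + j) w
    g2b = get-swapAt-other j (3 + j) w (λ e → n≢2+n (sym e)) (λ e → n≢1+n (sym e))
    g2c : get (suc j) w2 ≡ get (2 + j) w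
    g2c = get-swapAt-fst j w vk
    dd2 : Descent (2 + j) w2
    dd2 = vd2 , subst₂ _<_ (sym g2b) (sym g2a) (<-trans ltd ltk)
    ld2 : lastDescent w2 ≡ 2 + j
    ld2 = lastDescent-unique w2 (2 + j) dd2 (λ i lti di → aft i lti
      (Descent-swapAt-far⁻ i (suc j) w (inj₂ lti) di))
    g3a : get (2 + j) w3 ≡ get (3 + j) w
    g3a = trans (get-swapAt-fst (suc j) w2 vd2) g2b
    g3b : get (suc j) w3 ≡ get (2 + j) w
    g3b = trans (get-swapAt-other (suc j) (suc j) w2 n≢1+n n≢2+n) g2c
    g3c : get (3 + j) w3 ≡ get (suc j) w
    g3c = trans (get-swapAt-snd (suc j) w2 vd2) g2a
    dk3 : Descent (suc j) w3
    dk3 = subst (2 + j ≤_) (sym (trans (length-swapAt (2 + j) w2) (length-swapAt (suc j) w))) vk , subst₂ _<_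
      (sym g3a) (sym g3b) ltd
    hyp : ∀ i → 2 + j < i → i ≤ length w3 → get (2 + j) w3 < get i w3
    hyp i lti li with m≤n⇒m<n∨m≡n lti
    ... | inj₂ e rewrite sym e | g3c | g3a = <-trans ltd ltk
    ... | inj₁ lt2 rewrite g3a = subst (get (3 + j) w <_) (sym gi)
        (get-increasing w dw (3 + j) i (s≤s z≤n) lt2 li2 (λ i2 l1 _ → aft i2 l1))
      where
      li2 : i ≤ length w
      li2 = subst (i ≤_) (trans (length-swapAt (2 + j) w2) (length-swapAt (suc j) w)) li
      gi : get i w3 ≡ get i w
      gi = trans (get-swapAt-other (suc j) i w2 (λ e → <-irrefl (sym e) (<-trans (n<1+n _) lt2))
        (λ e → <-irrefl (sym e) lt2))
                 (get-swapAt-other j i w (λ e → <-irrefl (sym e) (<-trans (n<1+n _) (<-trans (n<1+n _) lt2)))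
                   (λ e → <-irrefl (sym e) (<-trans (n<1+n _) lt2)))

Unique-resp-↭ : ∀ {xs ys : List ℕ} → xs ↭ ys → Unique xs → Unique ys
Unique-resp-↭ ↭.refl u = u
Unique-resp-↭ (↭.prep x p) (a ∷ u) = All-resp-↭ p a ∷ Unique-resp-↭ p u
Unique-resp-↭ (↭.swap x y p) ((x≢y ∷ ax) ∷ ay ∷ u) =
  ((λ e → x≢y (sym e)) ∷ All-resp-↭ p ay) ∷ All-resp-↭ p ax ∷ Unique-resp-↭ p u
Unique-resp-↭ (↭.trans p q) u = Unique-resp-↭ q (Unique-resp-↭ p u)

Unique-idWord : ∀ n → Unique (idWord n)
Unique-idWord n = Unique.map⁺ suc-injective (Unique.upTo⁺ n)

Occurs⇒∈ : ∀ v u → Occurs v u → v ∈ u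
Occurs⇒∈ v (x ∷ u) (suc zero , _ , g) = here (sym g)
Occurs⇒∈ v (x ∷ u) (suc (suc k) , (_ , s≤s ik) , g) = there (Occurs⇒∈ v u (suc k , (s≤s z≤n , ik) , g))

∈⇒Occurs : ∀ v u → v ∈ u → Occurs v u
∈⇒Occurs v (x ∷ u) (here e) = 1 , (s≤s z≤n , s≤s z≤n) , sym e
∈⇒Occurs v (x ∷ u) (there a) with ∈⇒Occurs v u a
... | suc k , (_ , ik) , g = suc (suc k) , (s≤s z≤n , s≤s ik) , g

All-≢-Occurs : ∀ x xs y → All (x ≢_) xs → Occurs y xs → x ≢ y
All-≢-Occurs x (z ∷ xs) y (h ∷ hs) (suc zero , _ , g) e = h (trans e (sym g))
All-≢-Occurs x (z ∷ xs) y (h ∷ hs) (suc (suc k) , (_ , s≤s ik) , g) e = All-≢-Occurs x xs y hs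
  (suc k , (s≤s z≤n , ik) , g) e

Unique⇒Distinct : ∀ u → Unique u → Distinct u
Unique⇒Distinct (x ∷ u) (a ∷ un) (suc zero) (suc zero) _ _ e = refl
Unique⇒Distinct (x ∷ u) (a ∷ un) (suc zero) (suc (suc k)) _ (_ , s≤s ik) e = ⊥-elim
  (All-≢-Occurs x u _ a (suc k , (s≤s z≤n , ik) , refl) e)
Unique⇒Distinct (x ∷ u) (a ∷ un) (suc (suc j)) (suc zero) (_ , s≤s ij) _ e = ⊥-elim
  (All-≢-Occurs x u _ a (suc j , (s≤s z≤n , ij) , refl) (sym e))
Unique⇒Distinct (x ∷ u) (a ∷ un) (suc (suc j)) (suc (suc k)) (_ , s≤s ij) (_ , s≤s ik) e =
  cong suc (Unique⇒Distinct u un (suc j) (suc k) (s≤s z≤n , ij) (s≤s z≤n , ik) e)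

IsPerm⇒Perm : ∀ n w → IsPerm n w → Perm n w
IsPerm⇒Perm n w p = Unique⇒Distinct w (Unique-resp-↭ (↭-sym p) (Unique-idWord n)) ,
  trans (↭-length p) (length-idWord n) ,
  (λ v h → ∈⇒Occurs v w (∈-resp-↭ (↭-sym p) (Occurs⇒∈ v (idWord n) (Occurs-idWord n v h)))) ,
  (λ v m → proj₂ (proj₂ (proj₂ (Perm-id n))) v (∈⇒Occurs v (idWord n) (∈-resp-↭ p (Occurs⇒∈ v w m))))

length-filter-filter : ∀ {A : Set} (P f : A → Bool) L →
  length (filterᵇ f (filterᵇ P L)) ≡ count (λ τ → P τ ∧ f τ) L
length-filter-filter P f [] = refl
length-filter-filter P f (x ∷ L) with P x
... | false = length-filter-filter P f L
... | true with f x
...   | true = cong suc (length-filter-filter P f L)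
...   | false = length-filter-filter P f L

count-cong-All : ∀ {A : Set} (Q : A → Set) (f g : A → Bool) L → All Q L → (∀ τ → Q τ → f τ ≡ g τ) →
  count f L ≡ count g L
count-cong-All Q f g [] [] h = refl
count-cong-All Q f g (x ∷ L) (q ∷ qs) h rewrite count-∷ f x L | count-∷ g x L | h x q | count-cong-All Q f g
  L qs h = refl

≡ᵇ-sym : ∀ m k → (m ≡ᵇ k) ≡ (k ≡ᵇ m)
≡ᵇ-sym zero zero = refl
≡ᵇ-sym zero (suc k) = refl
≡ᵇ-sym (suc m) zero = refl
≡ᵇ-sym (suc m) (suc k) = ≡ᵇ-sym m k

t≡mismatches₀ : ∀ n w a → Perm n w → t n w a ≡ mismatches n w a 0
t≡mismatches₀ n w a p = trans (length-filter-filter (isTriple w) _ (allTriples n))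
  (count-cong-All (InRange³ n) _ _ (allTriples n) (All-InRange³-allTriples n) pt)
  where
  pt : ∀ τ → InRange³ n τ →
    (isTriple w τ ∧ not (Γ n (amin w) τ ≡ᵇ Γ n a τ)) ≡ (isTriple w τ ∧ not (Γ n a τ ≡ᵇ 0))
  pt (a1 , a2 , a3) (h1 , h2 , h3) with TripleOf? w a1 a2 a3
  ... | yes tr rewrite TripleOf⇒isTriple w a1 a2 a3 tr | Γ-amin n (inv w) w refl p a1 a2 a3 h1 h2 h3 tr =
      cong not (≡ᵇ-sym 0 (Γ n a (a1 , a2 , a3)))
  ... | no ntr rewrite ¬TripleOf⇒isTriple w a1 a2 a3 ntr = refl

triples : ℕ → List ℕ → ℕ
triples n w = count (isTriple w) (allTriples n)

mismatches-sum : ∀ n w a → mismatches n w a 0 + mismatches n w a 1 ≡ triples n w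
mismatches-sum n w a = sym (count-split (isTriple w) _ _ (allTriples n) pt)
  where
  pt : ∀ τ → bit (isTriple w τ) ≡ bit (isTriple w τ ∧ not (Γ n a τ ≡ᵇ 0)) + bit
    (isTriple w τ ∧ not (Γ n a τ ≡ᵇ 1))
  pt (a1 , a2 , a3) with isTriple w (a1 , a2 , a3)
  ... | false = refl
  ... | true with P n a a3 a2 <ᵇ P n a a2 a1
  ...   | true = refl
  ...   | false = refl

-- The extremes

module Extremes (n : ℕ) (w : List ℕ) (pw : IsPerm n w) where
  p : Perm n w
  p = IsPerm⇒Perm n w pw

  module Min = BraidDescent n firstDescent 0 (firstDescent-Descent n) (firstDescent-swapAt n)
  module Max = BraidDescent n lastDescent 1 (lastDescent-Descent n) (lastDescent-swapAt n)

  amin-Reduced : Reduced n w (amin w)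
  amin-Reduced = Greedy.greedy-Reduced n firstDescent (firstDescent-Descent n) w p

  amax-Reduced : Reduced n w (amax w)
  amax-Reduced = Greedy.greedy-Reduced n lastDescent (lastDescent-Descent n) w p

  t+mismatches₁ : ∀ x → t n w x + mismatches n w x 1 ≡ triples n w
  t+mismatches₁ x = trans (cong (_+ mismatches n w x 1) (t≡mismatches₀ n w x p)) (mismatches-sum n w x)

  amin-≤C : ∀ N (b : RW n w) → t n w (proj₁ b) ≤ N → _≤C_ {n} {w} (amin w , amin-Reduced) b
  amin-≤C N (b , rb) le with Min.greedyOrImprovable (inv w) w b refl p rb
  ... | inj₁ s = inj₁ (∼-sym b (amin w) s)
  ... | inj₂ (a′ , b′ , s , br , rb′ , h) = via N le
    where
    t-a′ : t n w a′ ≡ suc (t n w b′)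
    t-a′ = trans (t≡mismatches₀ n w a′ p) (trans h (cong suc (sym (t≡mismatches₀ n w b′ p))))
    cov : Cover n w b′ b
    cov = b′ , a′ , ε , s , Braid-sym a′ b′ br , t-a′
    t< : t n w b′ < t n w b
    t< = subst (t n w b′ <_) (sym (trans (t-∼ n w b a′ s) t-a′)) ≤-refl
    via : ∀ N → t n w b ≤ N → _≤C_ {n} {w} (amin w , amin-Reduced) (b , rb)
    via zero le′ = ⊥-elim (1+n≰n (≤-trans t< (≤-trans le′ z≤n)))
    via (suc N) le′ with amin-≤C N (b′ , rb′) (≤-pred (≤-trans t< le′))
    ... | inj₁ e = inj₂ (∼-Lt n w (amin w) b′ b e [ cov ])
    ... | inj₂ lt = inj₂ (Lt-trans n w (amin w) b′ b lt [ cov ])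

  ≤C-amax : ∀ N (b : RW n w) → mismatches n w (proj₁ b) 1 ≤ N → _≤C_ {n} {w} b (amax w , amax-Reduced)
  ≤C-amax N (b , rb) le with Max.greedyOrImprovable (inv w) w b refl p rb
  ... | inj₁ s = inj₁ s
  ... | inj₂ (a′ , b′ , s , br , rb′ , h) = via N le
    where
    t-b′ : t n w b′ ≡ suc (t n w a′)
    t-b′ = +-cancelʳ-≡ (mismatches n w b′ 1) _ _
      (trans (t+mismatches₁ b′) (trans (sym (t+mismatches₁ a′)) (trans (cong (t n w a′ +_) h) (+-suc _ _))))
    cov : Cover n w b b′
    cov = a′ , b′ , s , ε , br , t-b′
    mismatches-b : mismatches n w b 1 ≡ mismatches n w a′ 1
    mismatches-b = +-cancelˡ-≡ (t n w b) _ _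
      (trans (t+mismatches₁ b) (trans (sym (t+mismatches₁ a′))
        (cong (_+ mismatches n w a′ 1) (sym (t-∼ n w b a′ s)))))
    m< : mismatches n w b′ 1 < mismatches n w b 1
    m< = subst (mismatches n w b′ 1 <_) (sym (trans mismatches-b h)) ≤-refl
    via : ∀ N → mismatches n w b 1 ≤ N → _≤C_ {n} {w} (b , rb) (amax w , amax-Reduced)
    via zero le′ = ⊥-elim (1+n≰n (≤-trans m< (≤-trans le′ z≤n)))
    via (suc N) le′ with ≤C-amax N (b′ , rb′) (≤-pred (≤-trans m< le′))
    ... | inj₁ e = inj₂ (Lt-∼ n w b b′ (amax w) [ cov ] e)
    ... | inj₂ lt = inj₂ (Lt-trans n w b b′ (amax w) [ cov ] lt)

mainTheorem4 : (n : ℕ) → 2 ≤ n → (w : List ℕ) → IsPerm n w →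
  IsPartialOrder (_≈C_ {n} {w}) (_≤C_ {n} {w}) ×
    (∀ (a b : RW n w) → a ≈C b → t n w (Σ.proj₁ a) ≡ t n w (Σ.proj₁ b)) ×
      (∀ (a b : RW n w) → CoversC a b → t n w (Σ.proj₁ b) ≡ suc (t n w (Σ.proj₁ a))) × Σ
        (Reduced n w (amin w)) (λ r → ∀ (b : RW n w) → (amin w , r) ≤C b) × Σ (Reduced n w (amax w))
          (λ r → ∀ (b : RW n w) → b ≤C (amax w , r))
mainTheorem4 n _ w pw =
  ≤C-isPartialOrder n w , t-≈C n w , t-CoversC n w ,
  (E.amin-Reduced , λ b → E.amin-≤C (t n w (proj₁ b)) b ≤-refl) ,
  (E.amax-Reduced , λ b → E.≤C-amax (mismatches n w (proj₁ b) 1) b ≤-refl)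
  where
  module E = Extremes n w pw
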